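{- For every finite set $\Gamma$ of MSO formulas and all core-wMSO$(?,+)$ formulas $\Phi_1,\Phi_2$: $\Phi_1\sim_\Gamma\Phi_2$ if and only if $\Gamma\vdash\Phi_1\approx\Phi_2$ in the core-wMSO$(?,+)$ proof system.
   Context: MSO over a finite alphabet $\Sigma$ (syntax $\top, P_a(x), x\le y, x\in X,\neg,\wedge,\forall x,\forall X$), interpreted over $(w,\sigma)$ with $w\in\Sigma^+$ and $\sigma$ a valuation (first-order variables to positions, second-order variables to sets of positions); $\Gamma\vdash\varphi$ refers to a fixed sound and complete proof system for MSO over finite nonempty words. step-wMSO over weights $R$: $\Psi::=r\mid\varphi\,?\,\Psi_1:\Psi_2$ ($[\![r]\!]=r$; conditional selects $\Psi_1$ if $\varphi$ holds, else $\Psi_2$). core-wMSO$(?,+)$: $\Phi::=\mathbf{0}\mid\prod_x\Psi\mid\varphi\,?\,\Phi_1:\Phi_2\mid\Phi_1+\Phi_2$, with semantics in finite multisets of words over $R$: $[\![\mathbf{0}]\!]=\emptyset$, $[\![\prod_x\Psi]\!](w,\sigma)$ the multiset with the single word $r_1\cdots r_{|w|}$, $r_i=[\![\Psi]\!](w,\sigma[x\mapsto i])$, conditional selecting by $\varphi$, $[\![\Phi_1+\Phi_2]\!]=[\![\Phi_1]\!]\uplus[\![\Phi_2]\!]$. $\chi_1\sim_\Gamma\chi_2$: equal semantics on all $(w,\sigma)$ satisfying all of $\Gamma$. The core-wMSO$(?,+)$ proof system derives $\Gamma\vdash\chi_1\approx\chi_2$ by: (ref), (sym), (trans); (cong?),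 (cong+) congruence for the conditional and $+$; (S1)/(C6) $\Gamma\vdash\chi_1\approx\chi_2\Rightarrow\Gamma\cup\{\varphi\}\vdash\chi_1\approx\chi_2$; (S2)/(C7) $\Gamma\vdash\neg\varphi\,?\,\chi_1:\chi_2\approx\varphi\,?\,\chi_2:\chi_1$; (S3)/(C8) $\Gamma\vdash\varphi\Rightarrow\Gamma\vdash\varphi\,?\,\chi_1:\chi_2\approx\chi_1$; (S4)/(C9) $\Gamma\cup\{\varphi\}\vdash\chi_1\approx\chi$ and $\Gamma\cup\{\neg\varphi\}\vdash\chi_2\approx\chi\Rightarrow\Gamma\vdash\varphi\,?\,\chi_1:\chi_2\approx\chi$ (S versions for step formulas, C versions for core formulas); (C1) $\Gamma\vdash\Phi+\mathbf{0}\approx\Phi$; (C2) $\Gamma\vdash\Phi_1+\Phi_2\approx\Phi_2+\Phi_1$; (C3) $\Gamma\vdash(\Phi_1+\Phi_2)+\Phi_3\approx\Phi_1+(\Phi_2+\Phi_3)$; (C4) $\Gamma\vdash\Psi_1\approx\Psi_2$ with $x$ not free in $\Gamma$ implies $\Gamma\vdash\prod_x\Psi_1\approx\prod_x\Psi_2$; (C5) $\Gamma\vdash\prod_x\Psi\approx\prod_y\Psi[y/x]$ if $y$ does not occur in $\Psi$; (C10) $\Gamma\vdash(\varphi\,?\,\Phi':\Phi'')+\Phi\approx\varphi\,?\,(\Phi'+\Phi):(\Phi''+\Phi)$. -}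

module Defs where

open import Data.Nat using (ℕ; suc)
open import Data.Nat.Properties using () renaming (_≟_ to _≟ℕ_)
open import Data.Fin using (Fin) renaming (_≤_ to _≤ᶠ_)
open import Data.Fin.Properties using (all?) renaming (_≤?_ to _≤ᶠ?_; _≟_ to _≟ᶠ_)
open import Data.Fin.Subset using (Subset) renaming (_∈_ to _∈ˢ_)
open import Data.Fin.Subset.Properties using (anySubset?) renaming (_∈?_ to _∈ˢ?_)
open import Data.Vec using (Vec; lookup)
open import Data.List using (List; []; _∷_; _++_; map)
open import Data.List.Relation.Unary.All using (All)
open import Data.List.Relation.Binary.Permutation.Propositional using (_↭_)
open import Data.Product using (_×_; _,_; ∃)
open import Data.Sum using (_⊎_)
open import Data.Bool using (if_then_else_)
open import Data.Empty using (⊥)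
open import Relation.Nullary using (¬_; Dec; yes; no; does)
open import Relation.Nullary.Decidable using (_×-dec_; ¬?)
open import Relation.Binary.PropositionalEquality using (_≡_; _≢_)
open import Function using (_∘_)

-- MSO over the finite alphabet Σ = Fin k.
-- First-order and second-order variables are both named by ℕ
-- (two separate namespaces).

FOVar SOVar : Set
FOVar = ℕ
SOVar = ℕ

data MSO (k : ℕ) : Set where
  ⊤ᴹ   : MSO k
  P    : Fin k → FOVar → MSO k
  _≤ᴹ_ : FOVar → FOVar → MSO k
  _∈ᴹ_ : FOVar → SOVar → MSO k
  ¬ᴹ_  : MSO k → MSO k
  _∧ᴹ_ : MSO k → MSO k → MSO k
  ∀¹   : FOVar → MSO k → MSO k
  ∀²   : SOVar → MSO k → MSO k

record Val (n : ℕ) : Set where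
  constructor val
  field
    fo : FOVar → Fin n
    so : SOVar → Subset n
open Val public

_[_↦¹_] : ∀ {n} → Val n → FOVar → Fin n → Val n
fo (σ [ x ↦¹ i ]) y = if does (y ≟ℕ x) then i else fo σ y
so (σ [ x ↦¹ i ]) = so σ

_[_↦²_] : ∀ {n} → Val n → SOVar → Subset n → Val n
fo (σ [ X ↦² S ]) = fo σ
so (σ [ X ↦² S ]) Y = if does (Y ≟ℕ X) then S else so σ Y

Sat : ∀ {k n} → Vec (Fin k) n → Val n → MSO k → Set
Sat w σ ⊤ᴹ        = Data.Unit.⊤ where import Data.Unit
Sat w σ (P a x)   = lookup w (fo σ x) ≡ a
Sat w σ (x ≤ᴹ y)  = fo σ x ≤ᶠ fo σ y
Sat w σ (x ∈ᴹ X)  = fo σ x ∈ˢ so σ X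
Sat w σ (¬ᴹ φ)    = ¬ Sat w σ φ
Sat w σ (φ ∧ᴹ ψ)  = Sat w σ φ × Sat w σ ψ
Sat w σ (∀¹ x φ)  = (i : Fin _) → Sat w (σ [ x ↦¹ i ]) φ
Sat w σ (∀² X φ)  = (S : Subset _) → Sat w (σ [ X ↦² S ]) φ

private
  allSubset? : ∀ {n} {Q : Subset n → Set} → (∀ S → Dec (Q S)) → Dec (∀ S → Q S)
  allSubset? {Q = Q} P? with anySubset? (λ S → ¬? (P? S))
  ... | yes (S , ¬p) = no (λ h → ¬p (h S))
  ... | no ¬∃ = yes (λ S → helper S (P? S))
    where
    helper : ∀ S → Dec (Q S) → Q S
    helper S (yes p) = p
    helper S (no ¬p) = Data.Empty.⊥-elim (¬∃ (S , ¬p)) where import Data.Empty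

sat? : ∀ {k n} (w : Vec (Fin k) n) (σ : Val n) (φ : MSO k) → Dec (Sat w σ φ)
sat? w σ ⊤ᴹ       = yes Data.Unit.tt where import Data.Unit
sat? w σ (P a x)  = lookup w (fo σ x) ≟ᶠ a
sat? w σ (x ≤ᴹ y) = fo σ x ≤ᶠ? fo σ y
sat? w σ (x ∈ᴹ X) = fo σ x ∈ˢ? so σ X
sat? w σ (¬ᴹ φ)   = ¬? (sat? w σ φ)
sat? w σ (φ ∧ᴹ ψ) = sat? w σ φ ×-dec sat? w σ ψ
sat? w σ (∀¹ x φ) = all? (λ i → sat? w (σ [ x ↦¹ i ]) φ)
sat? w σ (∀² X φ) = allSubset? (λ S → sat? w (σ [ X ↦² S ]) φ)

-- Semantic consequence over finite NONEMPTY words: Γ ⊨ φ.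
_⊨ᴹ_ : ∀ {k} → List (MSO k) → MSO k → Set
_⊨ᴹ_ {k} Γ φ = ∀ m (w : Vec (Fin k) (suc m)) (σ : Val (suc m)) →
               All (Sat w σ) Γ → Sat w σ φ

SoundComplete : ∀ {k} → (List (MSO k) → MSO k → Set) → Set
SoundComplete {k} _⊢_ = ∀ (Γ : List (MSO k)) (φ : MSO k) →
  (Γ ⊢ φ → Γ ⊨ᴹ φ) × (Γ ⊨ᴹ φ → Γ ⊢ φ)

FreeFO : ∀ {k} → FOVar → MSO k → Set
FreeFO x ⊤ᴹ       = ⊥
FreeFO x (P a y)  = x ≡ y
FreeFO x (y ≤ᴹ z) = x ≡ y ⊎ x ≡ z
FreeFO x (y ∈ᴹ X) = x ≡ y
FreeFO x (¬ᴹ φ)   = FreeFO x φ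
FreeFO x (φ ∧ᴹ ψ) = FreeFO x φ ⊎ FreeFO x ψ
FreeFO x (∀¹ y φ) = x ≢ y × FreeFO x φ
FreeFO x (∀² X φ) = FreeFO x φ

OccFO : ∀ {k} → FOVar → MSO k → Set
OccFO x ⊤ᴹ       = ⊥
OccFO x (P a y)  = x ≡ y
OccFO x (y ≤ᴹ z) = x ≡ y ⊎ x ≡ z
OccFO x (y ∈ᴹ X) = x ≡ y
OccFO x (¬ᴹ φ)   = OccFO x φ
OccFO x (φ ∧ᴹ ψ) = OccFO x φ ⊎ OccFO x ψ
OccFO x (∀¹ y φ) = x ≡ y ⊎ OccFO x φ
OccFO x (∀² X φ) = OccFO x φ

-- φ[y/x]: replace free occurrences of x by y.
ren : FOVar → FOVar → FOVar → FOVar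
ren y x z = if does (z ≟ℕ x) then y else z

substᴹ : ∀ {k} → FOVar → FOVar → MSO k → MSO k
substᴹ y x ⊤ᴹ       = ⊤ᴹ
substᴹ y x (P a z)  = P a (ren y x z)
substᴹ y x (z ≤ᴹ u) = ren y x z ≤ᴹ ren y x u
substᴹ y x (z ∈ᴹ X) = ren y x z ∈ᴹ X
substᴹ y x (¬ᴹ φ)   = ¬ᴹ substᴹ y x φ
substᴹ y x (φ ∧ᴹ ψ) = substᴹ y x φ ∧ᴹ substᴹ y x ψ
substᴹ y x (∀¹ z φ) = if does (z ≟ℕ x) then ∀¹ z φ else ∀¹ z (substᴹ y x φ)
substᴹ y x (∀² X φ) = ∀² X (substᴹ y x φ)

data Step (k : ℕ) (R : Set) : Set where
  wt    : R → Step k R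
  _?ˢ_∶_ : MSO k → Step k R → Step k R → Step k R

data Core (k : ℕ) (R : Set) : Set where
  𝟎      : Core k R
  ∏      : FOVar → Step k R → Core k R
  _?ᶜ_∶_ : MSO k → Core k R → Core k R → Core k R
  _⊕_    : Core k R → Core k R → Core k R

OccStep : ∀ {k R} → FOVar → Step k R → Set
OccStep x (wt r)         = ⊥
OccStep x (φ ?ˢ Ψ₁ ∶ Ψ₂) = OccFO x φ ⊎ OccStep x Ψ₁ ⊎ OccStep x Ψ₂

substˢ : ∀ {k R} → FOVar → FOVar → Step k R → Step k R
substˢ y x (wt r)         = wt r
substˢ y x (φ ?ˢ Ψ₁ ∶ Ψ₂) = substᴹ y x φ ?ˢ substˢ y x Ψ₁ ∶ substˢ y x Ψ₂

-- Semantics.  Finite multisets of words over R are lists of lists,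
-- compared up to permutation (_↭_).
⟦_⟧ˢ : ∀ {k R n} → Step k R → Vec (Fin k) n → Val n → R
⟦ wt r ⟧ˢ w σ = r
⟦ φ ?ˢ Ψ₁ ∶ Ψ₂ ⟧ˢ w σ =
  if does (sat? w σ φ) then ⟦ Ψ₁ ⟧ˢ w σ else ⟦ Ψ₂ ⟧ˢ w σ

⟦_⟧ᶜ : ∀ {k R n} → Core k R → Vec (Fin k) n → Val n → List (List R)
⟦ 𝟎 ⟧ᶜ w σ = []
⟦ ∏ x Ψ ⟧ᶜ w σ = map (λ i → ⟦ Ψ ⟧ˢ w (σ [ x ↦¹ i ])) (Data.List.allFin _) ∷ []
  where import Data.List
⟦ φ ?ᶜ Φ₁ ∶ Φ₂ ⟧ᶜ w σ =
  if does (sat? w σ φ) then ⟦ Φ₁ ⟧ᶜ w σ else ⟦ Φ₂ ⟧ᶜ w σ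
⟦ Φ₁ ⊕ Φ₂ ⟧ᶜ w σ = ⟦ Φ₁ ⟧ᶜ w σ ++ ⟦ Φ₂ ⟧ᶜ w σ

_∼[_]_ : ∀ {k R} → Core k R → List (MSO k) → Core k R → Set
_∼[_]_ {k} Φ₁ Γ Φ₂ = ∀ m (w : Vec (Fin k) (suc m)) (σ : Val (suc m)) →
  All (Sat w σ) Γ → ⟦ Φ₁ ⟧ᶜ w σ ↭ ⟦ Φ₂ ⟧ᶜ w σ

-- The core-wMSO(?,+) proof system, parameterised by the MSO proof system ⊢.
-- Γ ∪ {φ} is rendered as φ ∷ Γ.

module ProofSystem {k : ℕ} {R : Set} (_⊢_ : List (MSO k) → MSO k → Set) where

  data _⊢ˢ_≈_ : List (MSO k) → Step k R → Step k R → Set where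
    refl  : ∀ {Γ Ψ} → Γ ⊢ˢ Ψ ≈ Ψ
    sym   : ∀ {Γ Ψ₁ Ψ₂} → Γ ⊢ˢ Ψ₁ ≈ Ψ₂ → Γ ⊢ˢ Ψ₂ ≈ Ψ₁
    trans : ∀ {Γ Ψ₁ Ψ₂ Ψ₃} → Γ ⊢ˢ Ψ₁ ≈ Ψ₂ → Γ ⊢ˢ Ψ₂ ≈ Ψ₃ → Γ ⊢ˢ Ψ₁ ≈ Ψ₃
    cong? : ∀ {Γ φ Ψ₁ Ψ₁' Ψ₂ Ψ₂'} → Γ ⊢ˢ Ψ₁ ≈ Ψ₁' → Γ ⊢ˢ Ψ₂ ≈ Ψ₂' →
            Γ ⊢ˢ (φ ?ˢ Ψ₁ ∶ Ψ₂) ≈ (φ ?ˢ Ψ₁' ∶ Ψ₂')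
    S1 : ∀ {Γ φ Ψ₁ Ψ₂} → Γ ⊢ˢ Ψ₁ ≈ Ψ₂ → (φ ∷ Γ) ⊢ˢ Ψ₁ ≈ Ψ₂
    S2 : ∀ {Γ φ Ψ₁ Ψ₂} → Γ ⊢ˢ ((¬ᴹ φ) ?ˢ Ψ₁ ∶ Ψ₂) ≈ (φ ?ˢ Ψ₂ ∶ Ψ₁)
    S3 : ∀ {Γ φ Ψ₁ Ψ₂} → Γ ⊢ φ → Γ ⊢ˢ (φ ?ˢ Ψ₁ ∶ Ψ₂) ≈ Ψ₁
    S4 : ∀ {Γ φ Ψ₁ Ψ₂ Ψ} → (φ ∷ Γ) ⊢ˢ Ψ₁ ≈ Ψ → ((¬ᴹ φ) ∷ Γ) ⊢ˢ Ψ₂ ≈ Ψ →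
         Γ ⊢ˢ (φ ?ˢ Ψ₁ ∶ Ψ₂) ≈ Ψ

  data _⊢ᶜ_≈_ : List (MSO k) → Core k R → Core k R → Set where
    refl  : ∀ {Γ Φ} → Γ ⊢ᶜ Φ ≈ Φ
    sym   : ∀ {Γ Φ₁ Φ₂} → Γ ⊢ᶜ Φ₁ ≈ Φ₂ → Γ ⊢ᶜ Φ₂ ≈ Φ₁
    trans : ∀ {Γ Φ₁ Φ₂ Φ₃} → Γ ⊢ᶜ Φ₁ ≈ Φ₂ → Γ ⊢ᶜ Φ₂ ≈ Φ₃ → Γ ⊢ᶜ Φ₁ ≈ Φ₃
    cong? : ∀ {Γ φ Φ₁ Φ₁' Φ₂ Φ₂'} → Γ ⊢ᶜ Φ₁ ≈ Φ₁' → Γ ⊢ᶜ Φ₂ ≈ Φ₂' →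
            Γ ⊢ᶜ (φ ?ᶜ Φ₁ ∶ Φ₂) ≈ (φ ?ᶜ Φ₁' ∶ Φ₂')
    cong+ : ∀ {Γ Φ₁ Φ₁' Φ₂ Φ₂'} → Γ ⊢ᶜ Φ₁ ≈ Φ₁' → Γ ⊢ᶜ Φ₂ ≈ Φ₂' →
            Γ ⊢ᶜ (Φ₁ ⊕ Φ₂) ≈ (Φ₁' ⊕ Φ₂')
    C1 : ∀ {Γ Φ} → Γ ⊢ᶜ (Φ ⊕ 𝟎) ≈ Φ
    C2 : ∀ {Γ Φ₁ Φ₂} → Γ ⊢ᶜ (Φ₁ ⊕ Φ₂) ≈ (Φ₂ ⊕ Φ₁)
    C3 : ∀ {Γ Φ₁ Φ₂ Φ₃} → Γ ⊢ᶜ ((Φ₁ ⊕ Φ₂) ⊕ Φ₃) ≈ (Φ₁ ⊕ (Φ₂ ⊕ Φ₃))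
    C4 : ∀ {Γ x Ψ₁ Ψ₂} → All (λ φ → ¬ FreeFO x φ) Γ → Γ ⊢ˢ Ψ₁ ≈ Ψ₂ →
         Γ ⊢ᶜ ∏ x Ψ₁ ≈ ∏ x Ψ₂
    C5 : ∀ {Γ x y Ψ} → ¬ OccStep y Ψ → Γ ⊢ᶜ ∏ x Ψ ≈ ∏ y (substˢ y x Ψ)
    C6 : ∀ {Γ φ Φ₁ Φ₂} → Γ ⊢ᶜ Φ₁ ≈ Φ₂ → (φ ∷ Γ) ⊢ᶜ Φ₁ ≈ Φ₂
    C7 : ∀ {Γ φ Φ₁ Φ₂} → Γ ⊢ᶜ ((¬ᴹ φ) ?ᶜ Φ₁ ∶ Φ₂) ≈ (φ ?ᶜ Φ₂ ∶ Φ₁)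
    C8 : ∀ {Γ φ Φ₁ Φ₂} → Γ ⊢ φ → Γ ⊢ᶜ (φ ?ᶜ Φ₁ ∶ Φ₂) ≈ Φ₁
    C9 : ∀ {Γ φ Φ₁ Φ₂ Φ} → (φ ∷ Γ) ⊢ᶜ Φ₁ ≈ Φ → ((¬ᴹ φ) ∷ Γ) ⊢ᶜ Φ₂ ≈ Φ →
         Γ ⊢ᶜ (φ ?ᶜ Φ₁ ∶ Φ₂) ≈ Φ
    C10 : ∀ {Γ φ Φ' Φ'' Φ} →
          Γ ⊢ᶜ ((φ ?ᶜ Φ' ∶ Φ'') ⊕ Φ) ≈ (φ ?ᶜ (Φ' ⊕ Φ) ∶ (Φ'' ⊕ Φ))

open ProofSystem public

-- For completeness, C10 pulls conditionals to the
-- top, where C9 eliminates them by splitting the context, until both sides are sums of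
-- products; C5 renames all their bound variables to one fresh z. The context is then split
-- on every formula ∃z (π ∧ π′) with π, π′ leaf guards of the step formulas. An unsatisfiable
-- branch proves ¬⊤ and hence everything. In a satisfiable branch fix a model: each product on
-- the left yields there the same word as some product on the right, and as every pair of
-- leaves that holds jointly in some model is then realised in the fixed one, the two step
-- formulas agree in all models; step completeness (S4 down to constants) and C4 make this a
-- derivation. All these case distinctions are constructive because MSO satisfiability over
-- finite words is decidable: formulas compile to deterministic automata over letters marked
-- by the variables (Büchi), whose emptiness is decided by pumping.

module Submission where

open import Defs
open import Data.Nat using (ℕ; zero; suc; _+_; _∸_; _*_; _^_; _⊔_; _≤_; _<_; _<?_; z≤n; s≤s)
open import Data.Nat.Induction using (<-rec)
open import Data.Nat.Properties using (_≟_)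
import Data.Nat.Properties as ℕ
open import Data.Fin using (Fin)
open import Data.Fin.Properties using (remQuot-combine; any?; <⇒≢; 2↔Bool; ∀-cons; pigeonhole; toℕ<n)
open import Data.Fin.Patterns using (0F; 1F; 2F)
import Data.Fin as Fin
open import Data.Fin.Subset using (Subset)
import Data.Fin.Subset as Subset
open import Data.Fin.Subset.Properties using (x∈⁅x⁆; x∈⁅y⁆⇒x≡y; anySubset?)
import Data.Fin.Subset.Properties as Subset
open import Data.Vec using (Vec; lookup; tabulate; []; _∷_)
import Data.Vec as Vec
import Data.Vec.Properties as Vec
open import Data.Vec.Functional using () renaming (_∷_ to _◂_)
open import Data.List
  using (List; []; _∷_; _++_; map; allFin; foldl; foldr; length; take; drop; concatMap; cartesianProductWith)
import Data.List as List
import Data.List.Properties as List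
open import Data.List.Relation.Unary.All using (All; []; _∷_)
import Data.List.Relation.Unary.All as All
import Data.List.Relation.Unary.All.Properties as AllP
open import Data.List.Relation.Binary.Subset.Propositional using (_⊆_)
open import Data.List.Relation.Unary.Any using (here; there)
open import Data.List.Membership.Propositional using (_∈_)
open import Data.List.Membership.Propositional.Properties
  using (∈-map⁺; ∈-map⁻; ∈-++⁺ˡ; ∈-++⁺ʳ; ∈-++⁻; ∈-∃++; ∈-concat⁺′; ∈-cartesianProductWith⁺)
open import Data.List.Relation.Binary.Permutation.Propositional
  using (_↭_; ↭-refl; ↭-reflexive; ↭-sym; ↭-trans)
import Data.List.Relation.Binary.Permutation.Propositional as ↭
import Data.List.Relation.Binary.Permutation.Propositional.Properties as ↭
open import Data.Product using (_×_; _,_; proj₁; proj₂; ∃; uncurry)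
import Data.Product as Product
open import Data.Sum using (_⊎_; inj₁; inj₂)
open import Data.Bool using (Bool; true; false; if_then_else_; _∨_)
import Data.Bool.Properties as Bool
open import Data.Empty using (⊥; ⊥-elim)
open import Data.Unit using (⊤; tt)
open import Function using (id; _∘_; case_of_)
open import Function.Bundles using (_⇔_; mk⇔; Equivalence; Inverse)
import Function.Properties.Equivalence as ⇔
open import Function.Related.TypeIsomorphisms using (¬-cong-⇔)
open import Data.Product.Function.NonDependent.Propositional using (_×-⇔_)
open import Relation.Nullary using (¬_; Dec; yes; no; does; contradiction)
import Relation.Nullary.Decidable as Dec
open import Relation.Nullary.Decidable using (dec-true; dec-false; does-⇔; decidable-stable; ¬?; _×-dec_)
open import Relation.Binary.PropositionalEquality
  using (_≡_; _≢_; refl; cong; cong₂; subst; subst₂)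
import Relation.Binary.PropositionalEquality as ≡

open Equivalence using (to; from)

subst-⇔ : ∀ {A : Set} (Q : A → Set) {a b} → a ≡ b → Q a ⇔ Q b
subst-⇔ Q refl = ⇔.refl

if-yes : ∀ {A P : Set} (P? : Dec P) {a b : A} → P → (if does P? then a else b) ≡ a
if-yes P? p = cong (if_then _ else _) (dec-true P? p)

if-no : ∀ {A P : Set} (P? : Dec P) {a b : A} → ¬ P → (if does P? then a else b) ≡ b
if-no P? ¬p = cong (if_then _ else _) (dec-false P? ¬p)

-- Valuations, free variables and substitution

module _ {n : ℕ} (σ : Val n) where

  ↦¹-same : ∀ x i → fo (σ [ x ↦¹ i ]) x ≡ i
  ↦¹-same x i = if-yes (x ≟ x) refl

  ↦¹-other : ∀ {x y} i → y ≢ x → fo (σ [ x ↦¹ i ]) y ≡ fo σ y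
  ↦¹-other {x} {y} i = if-no (y ≟ x)

  ↦¹-self : ∀ x y → fo (σ [ x ↦¹ fo σ x ]) y ≡ fo σ y
  ↦¹-self x y with y ≟ x
  ... | yes refl = ↦¹-same y (fo σ y)
  ... | no y≢x = ↦¹-other (fo σ x) y≢x

  ↦²-same : ∀ X S → so (σ [ X ↦² S ]) X ≡ S
  ↦²-same X S = if-yes (X ≟ X) refl

  ↦²-other : ∀ {X Y} S → Y ≢ X → so (σ [ X ↦² S ]) Y ≡ so σ Y
  ↦²-other {X} {Y} S = if-no (Y ≟ X)

FreeSO : ∀ {k} → SOVar → MSO k → Set
FreeSO X ⊤ᴹ       = ⊥
FreeSO X (P a y)  = ⊥
FreeSO X (y ≤ᴹ z) = ⊥
FreeSO X (y ∈ᴹ Y) = X ≡ Y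
FreeSO X (¬ᴹ φ)   = FreeSO X φ
FreeSO X (φ ∧ᴹ ψ) = FreeSO X φ ⊎ FreeSO X ψ
FreeSO X (∀¹ y φ) = FreeSO X φ
FreeSO X (∀² Y φ) = X ≢ Y × FreeSO X φ

FreeFO⇒OccFO : ∀ {k} (φ : MSO k) {x} → FreeFO x φ → OccFO x φ
FreeFO⇒OccFO (P a y)  f        = f
FreeFO⇒OccFO (y ≤ᴹ z) f        = f
FreeFO⇒OccFO (y ∈ᴹ X) f        = f
FreeFO⇒OccFO (¬ᴹ φ)   f        = FreeFO⇒OccFO φ f
FreeFO⇒OccFO (φ ∧ᴹ ψ) (inj₁ f) = inj₁ (FreeFO⇒OccFO φ f)
FreeFO⇒OccFO (φ ∧ᴹ ψ) (inj₂ f) = inj₂ (FreeFO⇒OccFO ψ f)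
FreeFO⇒OccFO (∀¹ y φ) (_ , f)  = inj₂ (FreeFO⇒OccFO φ f)
FreeFO⇒OccFO (∀² X φ) f        = FreeFO⇒OccFO φ f

supᴹ : ∀ {k} → MSO k → ℕ
supᴹ ⊤ᴹ       = 0
supᴹ (P a x)  = x
supᴹ (x ≤ᴹ y) = x ⊔ y
supᴹ (x ∈ᴹ X) = x ⊔ X
supᴹ (¬ᴹ φ)   = supᴹ φ
supᴹ (φ ∧ᴹ ψ) = supᴹ φ ⊔ supᴹ ψ
supᴹ (∀¹ x φ) = x ⊔ supᴹ φ
supᴹ (∀² X φ) = X ⊔ supᴹ φ

OccFO-≤ : ∀ {k} (φ : MSO k) {x} → OccFO x φ → x ≤ supᴹ φ
OccFO-≤ (P a x)  refl     = ℕ.≤-refl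
OccFO-≤ (x ≤ᴹ y) (inj₁ refl) = ℕ.m≤m⊔n x y
OccFO-≤ (x ≤ᴹ y) (inj₂ refl) = ℕ.m≤n⊔m x y
OccFO-≤ (x ∈ᴹ X) refl     = ℕ.m≤m⊔n x X
OccFO-≤ (¬ᴹ φ)   o        = OccFO-≤ φ o
OccFO-≤ (φ ∧ᴹ ψ) (inj₁ o) = ℕ.m≤n⇒m≤n⊔o (supᴹ ψ) (OccFO-≤ φ o)
OccFO-≤ (φ ∧ᴹ ψ) (inj₂ o) = ℕ.m≤n⇒m≤o⊔n (supᴹ φ) (OccFO-≤ ψ o)
OccFO-≤ (∀¹ x φ) (inj₁ refl) = ℕ.m≤m⊔n x (supᴹ φ)
OccFO-≤ (∀¹ x φ) (inj₂ o) = ℕ.m≤n⇒m≤o⊔n x (OccFO-≤ φ o)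
OccFO-≤ (∀² X φ) o        = ℕ.m≤n⇒m≤o⊔n X (OccFO-≤ φ o)

FreeSO-≤ : ∀ {k} (φ : MSO k) {X} → FreeSO X φ → X ≤ supᴹ φ
FreeSO-≤ (x ∈ᴹ X) refl     = ℕ.m≤n⊔m x X
FreeSO-≤ (¬ᴹ φ)   f        = FreeSO-≤ φ f
FreeSO-≤ (φ ∧ᴹ ψ) (inj₁ f) = ℕ.m≤n⇒m≤n⊔o (supᴹ ψ) (FreeSO-≤ φ f)
FreeSO-≤ (φ ∧ᴹ ψ) (inj₂ f) = ℕ.m≤n⇒m≤o⊔n (supᴹ φ) (FreeSO-≤ ψ f)
FreeSO-≤ (∀¹ x φ) f        = ℕ.m≤n⇒m≤o⊔n x (FreeSO-≤ φ f)
FreeSO-≤ (∀² Y φ) (_ , f)  = ℕ.m≤n⇒m≤o⊔n Y (FreeSO-≤ φ f)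

∃¹ : ∀ {k} → FOVar → MSO k → MSO k
∃¹ x φ = ¬ᴹ ∀¹ x (¬ᴹ φ)

∃² : ∀ {k} → SOVar → MSO k → MSO k
∃² X φ = ¬ᴹ ∀² X (¬ᴹ φ)

closure : ∀ {k} → ℕ → MSO k → MSO k
closure zero    φ = φ
closure (suc B) φ = ∃¹ B (∃² B (closure B φ))

⋀ : ∀ {k} → List (MSO k) → MSO k
⋀ = foldr _∧ᴹ_ ⊤ᴹ

module _ {k n : ℕ} (w : Vec (Fin k) n) where

  Sat-coincidence : ∀ (φ : MSO k) {σ τ : Val n} →
    (∀ x → FreeFO x φ → fo σ x ≡ fo τ x) → (∀ X → FreeSO X φ → so σ X ≡ so τ X) →
    Sat w σ φ → Sat w τ φ
  Sat-coincidence ⊤ᴹ       hx hX s = tt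
  Sat-coincidence (P a x)  hx hX s = subst (λ i → lookup w i ≡ a) (hx x refl) s
  Sat-coincidence (x ≤ᴹ y) hx hX s = subst₂ Fin._≤_ (hx x (inj₁ refl)) (hx y (inj₂ refl)) s
  Sat-coincidence (x ∈ᴹ X) hx hX s = subst₂ Subset._∈_ (hx x refl) (hX X refl) s
  Sat-coincidence (¬ᴹ φ)   hx hX s t =
    s (Sat-coincidence φ (λ x f → ≡.sym (hx x f)) (λ X f → ≡.sym (hX X f)) t)
  Sat-coincidence (φ ∧ᴹ ψ) hx hX (s , t) =
    Sat-coincidence φ (λ x → hx x ∘ inj₁) (λ X → hX X ∘ inj₁) s ,
    Sat-coincidence ψ (λ x → hx x ∘ inj₂) (λ X → hX X ∘ inj₂) t
  Sat-coincidence (∀¹ y φ) {σ} {τ} hx hX s i = Sat-coincidence φ hx′ hX (s i)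
    where
    hx′ : ∀ x → FreeFO x φ → fo (σ [ y ↦¹ i ]) x ≡ fo (τ [ y ↦¹ i ]) x
    hx′ x f with x ≟ y
    ... | yes refl = ≡.trans (↦¹-same σ x i) (≡.sym (↦¹-same τ x i))
    ... | no x≢y = ≡.trans (↦¹-other σ i x≢y) (≡.trans (hx x (x≢y , f)) (≡.sym (↦¹-other τ i x≢y)))
  Sat-coincidence (∀² Y φ) {σ} {τ} hx hX s S = Sat-coincidence φ hx hX′ (s S)
    where
    hX′ : ∀ X → FreeSO X φ → so (σ [ Y ↦² S ]) X ≡ so (τ [ Y ↦² S ]) X
    hX′ X f with X ≟ Y
    ... | yes refl = ≡.trans (↦²-same σ X S) (≡.sym (↦²-same τ X S))
    ... | no X≢Y = ≡.trans (↦²-other σ S X≢Y) (≡.trans (hX X (X≢Y , f)) (≡.sym (↦²-other τ S X≢Y)))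

  Sat-resp : ∀ (φ : MSO k) {σ τ : Val n} →
    (∀ x → fo σ x ≡ fo τ x) → (∀ X → so σ X ≡ so τ X) → Sat w σ φ → Sat w τ φ
  Sat-resp φ hx hX = Sat-coincidence φ (λ x _ → hx x) (λ X _ → hX X)

  Sat-substᴹ : ∀ (φ : MSO k) (τ : Val n) {x y} → ¬ OccFO y φ →
    Sat w τ (substᴹ y x φ) ⇔ Sat w (τ [ x ↦¹ fo τ y ]) φ
  Sat-coincidence-⇔ : ∀ (φ : MSO k) {σ τ : Val n} →
    (∀ x → FreeFO x φ → fo σ x ≡ fo τ x) → (∀ X → FreeSO X φ → so σ X ≡ so τ X) →
    Sat w σ φ ⇔ Sat w τ φ
  Sat-coincidence-⇔ φ hx hX = mk⇔ (Sat-coincidence φ hx hX)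
    (Sat-coincidence φ (λ x f → ≡.sym (hx x f)) (λ X f → ≡.sym (hX X f)))

  Sat-resp-⇔ : ∀ (φ : MSO k) {σ τ : Val n} →
    (∀ x → fo σ x ≡ fo τ x) → (∀ X → so σ X ≡ so τ X) → Sat w σ φ ⇔ Sat w τ φ
  Sat-resp-⇔ φ hx hX = mk⇔ (Sat-resp φ hx hX) (Sat-resp φ (≡.sym ∘ hx) (≡.sym ∘ hX))

  ren-↦¹ : ∀ (τ : Val n) x y z → fo τ (ren y x z) ≡ fo (τ [ x ↦¹ fo τ y ]) z
  ren-↦¹ τ x y z with z ≟ x
  ... | yes refl = ≡.trans (cong (fo τ) (if-yes (z ≟ z) refl)) (≡.sym (↦¹-same τ z _))
  ... | no z≢x = ≡.trans (cong (fo τ) (if-no (z ≟ x) z≢x)) (≡.sym (↦¹-other τ _ z≢x))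

  Sat-substᴹ ⊤ᴹ       τ _ = ⇔.refl
  Sat-substᴹ (P a z)  τ {x} {y} _ = subst-⇔ (λ i → lookup w i ≡ a) (ren-↦¹ τ x y z)
  Sat-substᴹ (z ≤ᴹ u) τ {x} {y} _ =
    ⇔.trans (subst-⇔ (λ i → i Fin.≤ fo τ (ren y x u)) (ren-↦¹ τ x y z))
            (subst-⇔ (λ j → fo (τ [ x ↦¹ fo τ y ]) z Fin.≤ j) (ren-↦¹ τ x y u))
  Sat-substᴹ (z ∈ᴹ X) τ {x} {y} _ = subst-⇔ (λ i → i Subset.∈ so τ X) (ren-↦¹ τ x y z)
  Sat-substᴹ (¬ᴹ φ)   τ y∉φ = ¬-cong-⇔ (Sat-substᴹ φ τ y∉φ)
  Sat-substᴹ (φ ∧ᴹ ψ) τ y∉φ = Sat-substᴹ φ τ (y∉φ ∘ inj₁) ×-⇔ Sat-substᴹ ψ τ (y∉φ ∘ inj₂)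
  Sat-substᴹ (∀² X φ) τ y∉φ = mk⇔
    (λ s S → to (Sat-substᴹ φ (τ [ X ↦² S ]) y∉φ) (s S))
    (λ s S → from (Sat-substᴹ φ (τ [ X ↦² S ]) y∉φ) (s S))
  Sat-substᴹ (∀¹ u φ) τ {x} {y} y∉φ with u ≟ x
  ... | yes refl = ⇔.trans (subst-⇔ (Sat w τ) (if-yes (u ≟ u) refl))
                           (Sat-coincidence-⇔ (∀¹ u φ) agree (λ _ _ → refl))
    where
    agree : ∀ v → FreeFO v (∀¹ u φ) → fo τ v ≡ fo (τ [ u ↦¹ fo τ y ]) v
    agree v (v≢u , _) = ≡.sym (↦¹-other τ _ v≢u)
  ... | no u≢x = ⇔.trans (subst-⇔ (Sat w τ) (if-no (u ≟ x) u≢x)) (mk⇔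
    (λ s i → to (⇔.trans (Sat-substᴹ φ (τ [ u ↦¹ i ]) (y∉φ ∘ inj₂)) (commute i)) (s i))
    (λ s i → from (⇔.trans (Sat-substᴹ φ (τ [ u ↦¹ i ]) (y∉φ ∘ inj₂)) (commute i)) (s i)))
    where
    y≢u : y ≢ u
    y≢u = y∉φ ∘ inj₁
    commute : ∀ i → Sat w (τ [ u ↦¹ i ] [ x ↦¹ fo (τ [ u ↦¹ i ]) y ]) φ
                  ⇔ Sat w (τ [ x ↦¹ fo τ y ] [ u ↦¹ i ]) φ
    commute i = Sat-resp-⇔ φ pointwise (λ _ → refl)
      where
      σ₁ σ₂ : Val n
      σ₁ = τ [ u ↦¹ i ]
      σ₂ = τ [ x ↦¹ fo τ y ]
      pointwise : ∀ v → fo (σ₁ [ x ↦¹ fo σ₁ y ]) v ≡ fo (σ₂ [ u ↦¹ i ]) v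
      pointwise v with v ≟ x | v ≟ u
      ... | yes refl | yes refl = contradiction refl u≢x
      ... | yes refl | no v≢u = ≡.trans (↦¹-same σ₁ v _)
          (≡.trans (↦¹-other τ i y≢u) (≡.sym (≡.trans (↦¹-other σ₂ i v≢u) (↦¹-same τ v _))))
      ... | no v≢x | yes refl = ≡.trans (↦¹-other σ₁ _ v≢x)
          (≡.trans (↦¹-same τ v i) (≡.sym (↦¹-same σ₂ v i)))
      ... | no v≢x | no v≢u = ≡.trans (↦¹-other σ₁ _ v≢x)
          (≡.trans (↦¹-other τ i v≢u) (≡.sym (≡.trans (↦¹-other σ₂ i v≢u) (↦¹-other τ _ v≢x))))

  Sat-∃¹ : ∀ (φ : MSO k) (σ : Val n) x → Sat w σ (∃¹ x φ) ⇔ ∃ λ i → Sat w (σ [ x ↦¹ i ]) φ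
  Sat-∃¹ φ σ x = mk⇔
    (λ ¬∀¬ → decidable-stable (any? λ i → sat? w (σ [ x ↦¹ i ]) φ) λ ¬∃ → ¬∀¬ λ i s → ¬∃ (i , s))
    (λ (i , s) ∀¬ → ∀¬ i s)

  Sat-∃² : ∀ (φ : MSO k) (σ : Val n) X → Sat w σ (∃² X φ) ⇔ ∃ λ S → Sat w (σ [ X ↦² S ]) φ
  Sat-∃² φ σ X = mk⇔
    (λ ¬∀¬ → decidable-stable (anySubset? λ S → sat? w (σ [ X ↦² S ]) φ) λ ¬∃ → ¬∀¬ λ S s → ¬∃ (S , s))
    (λ (S , s) ∀¬ → ∀¬ S s)

  closure-elim : ∀ B (φ : MSO k) σ → Sat w σ (closure B φ) → ∃ λ τ → Sat w τ φ
  closure-elim zero    φ σ s = σ , s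
  closure-elim (suc B) φ σ s with to (Sat-∃¹ (∃² B (closure B φ)) σ B) s
  ... | i , s′ with to (Sat-∃² (closure B φ) (σ [ B ↦¹ i ]) B) s′
  ... | S , s″ = closure-elim B φ _ s″

  closure-intro : ∀ B (φ : MSO k) {σ τ} →
    (∀ x → FreeFO x φ → B ≤ x → fo τ x ≡ fo σ x) → (∀ X → FreeSO X φ → B ≤ X → so τ X ≡ so σ X) →
    Sat w τ φ → Sat w σ (closure B φ)
  closure-intro zero φ hx hX = Sat-coincidence φ (λ x f → hx x f z≤n) (λ X f → hX X f z≤n)
  closure-intro (suc B) φ {σ} {τ} hx hX s =
    from (Sat-∃¹ (∃² B (closure B φ)) σ B) (fo τ B ,
      from (Sat-∃² (closure B φ) (σ [ B ↦¹ fo τ B ]) B) (so τ B ,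
      closure-intro B φ hx′ hX′ s))
    where
    hx′ : ∀ x → FreeFO x φ → B ≤ x → fo τ x ≡ fo (σ [ B ↦¹ fo τ B ]) x
    hx′ x f B≤x with x ≟ B
    ... | yes refl = ≡.sym (↦¹-same σ x _)
    ... | no x≢B = ≡.trans (hx x f (ℕ.≤∧≢⇒< B≤x (x≢B ∘ ≡.sym))) (≡.sym (↦¹-other σ _ x≢B))
    hX′ : ∀ X → FreeSO X φ → B ≤ X → so τ X ≡ so (σ [ B ↦¹ fo τ B ] [ B ↦² so τ B ]) X
    hX′ X f B≤X with X ≟ B
    ... | yes refl = ≡.sym (↦²-same (σ [ B ↦¹ fo τ B ]) X _)
    ... | no X≢B = ≡.trans (hX X f (ℕ.≤∧≢⇒< B≤X (X≢B ∘ ≡.sym))) (≡.sym (↦²-other (σ [ B ↦¹ fo τ B ]) _ X≢B))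

  Sat-⋀ : ∀ Γ σ → Sat w σ (⋀ Γ) ⇔ All (Sat w σ) Γ
  Sat-⋀ []      σ = mk⇔ (λ _ → []) (λ _ → tt)
  Sat-⋀ (φ ∷ Γ) σ = mk⇔ (λ (s , ss) → s ∷ to (Sat-⋀ Γ σ) ss) (λ { (s ∷ ss) → s , from (Sat-⋀ Γ σ) ss })

  All-Sat-↦¹ : ∀ {Γ : List (MSO k)} (σ : Val n) {x} i →
    All (λ φ → ¬ FreeFO x φ) Γ → All (Sat w σ) Γ → All (Sat w (σ [ x ↦¹ i ])) Γ
  All-Sat-↦¹ σ i [] [] = []
  All-Sat-↦¹ {φ ∷ _} σ {x} i (x∉φ ∷ x∉Γ) (s ∷ ss) =
    Sat-coincidence φ agree (λ _ _ → refl) s ∷ All-Sat-↦¹ σ i x∉Γ ss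
    where
    agree : ∀ v → FreeFO v φ → fo σ v ≡ fo (σ [ x ↦¹ i ]) v
    agree v f = ≡.sym (↦¹-other σ i λ { refl → x∉φ f })

-- Semantics of step and core formulas; soundness

module _ {k : ℕ} {R : Set} {n : ℕ} (w : Vec (Fin k) n) (σ : Val n) {φ : MSO k} (s : Sat w σ φ) where

  ?ˢ-yes : ∀ (Ψ₁ Ψ₂ : Step k R) → ⟦ φ ?ˢ Ψ₁ ∶ Ψ₂ ⟧ˢ w σ ≡ ⟦ Ψ₁ ⟧ˢ w σ
  ?ˢ-yes _ _ = if-yes (sat? w σ φ) s

  ?ᶜ-yes : ∀ (Φ₁ Φ₂ : Core k R) → ⟦ φ ?ᶜ Φ₁ ∶ Φ₂ ⟧ᶜ w σ ≡ ⟦ Φ₁ ⟧ᶜ w σ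
  ?ᶜ-yes _ _ = if-yes (sat? w σ φ) s

module _ {k : ℕ} {R : Set} {n : ℕ} (w : Vec (Fin k) n) (σ : Val n) {φ : MSO k} (¬s : ¬ Sat w σ φ) where

  ?ˢ-no : ∀ (Ψ₁ Ψ₂ : Step k R) → ⟦ φ ?ˢ Ψ₁ ∶ Ψ₂ ⟧ˢ w σ ≡ ⟦ Ψ₂ ⟧ˢ w σ
  ?ˢ-no _ _ = if-no (sat? w σ φ) ¬s

  ?ᶜ-no : ∀ (Φ₁ Φ₂ : Core k R) → ⟦ φ ?ᶜ Φ₁ ∶ Φ₂ ⟧ᶜ w σ ≡ ⟦ Φ₂ ⟧ᶜ w σ
  ?ᶜ-no _ _ = if-no (sat? w σ φ) ¬s

module _ {k : ℕ} {R : Set} where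

  _⊨ˢ_≈_ : List (MSO k) → Step k R → Step k R → Set
  Γ ⊨ˢ Ψ₁ ≈ Ψ₂ = ∀ m (w : Vec (Fin k) (suc m)) (σ : Val (suc m)) →
    All (Sat w σ) Γ → ⟦ Ψ₁ ⟧ˢ w σ ≡ ⟦ Ψ₂ ⟧ˢ w σ

  ⟦⟧ˢ-substˢ : ∀ {n} (w : Vec (Fin k) n) (Ψ : Step k R) (σ : Val n) {x y} i →
    ¬ OccStep y Ψ → ⟦ substˢ y x Ψ ⟧ˢ w (σ [ y ↦¹ i ]) ≡ ⟦ Ψ ⟧ˢ w (σ [ x ↦¹ i ])
  ⟦⟧ˢ-substˢ w (wt r) σ i y∉Ψ = refl
  ⟦⟧ˢ-substˢ {n} w (φ ?ˢ Ψ₁ ∶ Ψ₂) σ {x} {y} i y∉Ψ =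
    ≡.trans (cong (if_then _ else _) (does-⇔ same-condition (sat? w σʸ (substᴹ y x φ)) (sat? w σˣ φ)))
            (cong₂ (if _ then_else_) (⟦⟧ˢ-substˢ w Ψ₁ σ i (y∉Ψ ∘ inj₂ ∘ inj₁))
                                     (⟦⟧ˢ-substˢ w Ψ₂ σ i (y∉Ψ ∘ inj₂ ∘ inj₂)))
    where
    σʸ σˣ : Val n
    σʸ = σ [ y ↦¹ i ]
    σˣ = σ [ x ↦¹ i ]
    agree : ∀ v → FreeFO v φ → fo (σʸ [ x ↦¹ fo σʸ y ]) v ≡ fo σˣ v
    agree v f with v ≟ x
    ... | yes refl = ≡.trans (↦¹-same σʸ v _) (≡.trans (↦¹-same σ y i) (≡.sym (↦¹-same σ v i)))
    ... | no v≢x = ≡.trans (↦¹-other σʸ _ v≢x) (≡.trans (↦¹-other σ i v≢y) (≡.sym (↦¹-other σ i v≢x)))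
      where
      v≢y : v ≢ y
      v≢y refl = y∉Ψ (inj₁ (FreeFO⇒OccFO φ f))
    same-condition : Sat w σʸ (substᴹ y x φ) ⇔ Sat w σˣ φ
    same-condition = ⇔.trans (Sat-substᴹ w φ σʸ (y∉Ψ ∘ inj₁)) (Sat-coincidence-⇔ w φ agree (λ _ _ → refl))

  ?ᶜ-branchˡ : ∀ {Γ} φ (Φ′ Φ″ Φ : Core k R) → (φ ?ᶜ Φ′ ∶ Φ″) ∼[ Γ ] Φ → Φ′ ∼[ φ ∷ Γ ] Φ
  ?ᶜ-branchˡ φ Φ′ Φ″ Φ h m w σ (s ∷ Γσ) = subst (_↭ _) (?ᶜ-yes w σ s Φ′ Φ″) (h m w σ Γσ)

  ?ᶜ-branchʳ : ∀ {Γ} φ (Φ′ Φ″ Φ : Core k R) → (φ ?ᶜ Φ′ ∶ Φ″) ∼[ Γ ] Φ → Φ″ ∼[ (¬ᴹ φ) ∷ Γ ] Φ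
  ?ᶜ-branchʳ φ Φ′ Φ″ Φ h m w σ (¬s ∷ Γσ) = subst (_↭ _) (?ᶜ-no w σ ¬s Φ′ Φ″) (h m w σ Γσ)

module Soundness {k : ℕ} {R : Set} (_⊢_ : List (MSO k) → MSO k → Set)
                 (⊢-sound : ∀ {Γ φ} → Γ ⊢ φ → Γ ⊨ᴹ φ) where

  open ProofSystem {k} {R} _⊢_ using () renaming (_⊢ˢ_≈_ to _⊩ˢ_≈_; _⊢ᶜ_≈_ to _⊩ᶜ_≈_)

  soundˢ : ∀ {Γ Ψ₁ Ψ₂} → Γ ⊩ˢ Ψ₁ ≈ Ψ₂ → Γ ⊨ˢ Ψ₁ ≈ Ψ₂
  soundˢ refl m w σ Γσ = refl
  soundˢ (sym d) m w σ Γσ = ≡.sym (soundˢ d m w σ Γσ)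
  soundˢ (trans d e) m w σ Γσ = ≡.trans (soundˢ d m w σ Γσ) (soundˢ e m w σ Γσ)
  soundˢ (cong? {φ = φ} d e) m w σ Γσ with sat? w σ φ
  ... | yes _ = soundˢ d m w σ Γσ
  ... | no _ = soundˢ e m w σ Γσ
  soundˢ (S1 d) m w σ (_ ∷ Γσ) = soundˢ d m w σ Γσ
  soundˢ (S2 {φ = φ}) m w σ Γσ with sat? w σ φ
  ... | yes _ = refl
  ... | no _ = refl
  soundˢ (S3 {φ = φ} ⊢φ) m w σ Γσ with sat? w σ φ
  ... | yes _ = refl
  ... | no ¬φ = contradiction (⊢-sound ⊢φ m w σ Γσ) ¬φ
  soundˢ (S4 {φ = φ} d e) m w σ Γσ with sat? w σ φ
  ... | yes φσ = soundˢ d m w σ (φσ ∷ Γσ)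
  ... | no ¬φσ = soundˢ e m w σ (¬φσ ∷ Γσ)

  soundᶜ : ∀ {Γ Φ₁ Φ₂} → Γ ⊩ᶜ Φ₁ ≈ Φ₂ → Φ₁ ∼[ Γ ] Φ₂
  soundᶜ refl m w σ Γσ = ↭-refl
  soundᶜ (sym d) m w σ Γσ = ↭-sym (soundᶜ d m w σ Γσ)
  soundᶜ (trans d e) m w σ Γσ = ↭-trans (soundᶜ d m w σ Γσ) (soundᶜ e m w σ Γσ)
  soundᶜ (cong? {φ = φ} d e) m w σ Γσ with sat? w σ φ
  ... | yes _ = soundᶜ d m w σ Γσ
  ... | no _ = soundᶜ e m w σ Γσ
  soundᶜ (cong+ d e) m w σ Γσ = ↭.++⁺ (soundᶜ d m w σ Γσ) (soundᶜ e m w σ Γσ)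
  soundᶜ C1 m w σ Γσ = ↭-reflexive (List.++-identityʳ _)
  soundᶜ (C2 {Φ₁ = Φ₁} {Φ₂}) m w σ Γσ = ↭.++-comm (⟦ Φ₁ ⟧ᶜ w σ) (⟦ Φ₂ ⟧ᶜ w σ)
  soundᶜ (C3 {Φ₁ = Φ₁} {Φ₂} {Φ₃}) m w σ Γσ = ↭.++-assoc (⟦ Φ₁ ⟧ᶜ w σ) (⟦ Φ₂ ⟧ᶜ w σ) (⟦ Φ₃ ⟧ᶜ w σ)
  soundᶜ (C4 {x = x} x∉Γ d) m w σ Γσ = ↭-reflexive (cong (_∷ []) (List.map-cong
    (λ i → soundˢ d m w (σ [ x ↦¹ i ]) (All-Sat-↦¹ w σ i x∉Γ Γσ)) (allFin _)))
  soundᶜ (C5 {Ψ = Ψ} y∉Ψ) m w σ Γσ = ↭-reflexive (cong (_∷ []) (List.map-cong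
    (λ i → ≡.sym (⟦⟧ˢ-substˢ w Ψ σ i y∉Ψ)) (allFin _)))
  soundᶜ (C6 d) m w σ (_ ∷ Γσ) = soundᶜ d m w σ Γσ
  soundᶜ (C7 {φ = φ}) m w σ Γσ with sat? w σ φ
  ... | yes _ = ↭-refl
  ... | no _ = ↭-refl
  soundᶜ (C8 {φ = φ} ⊢φ) m w σ Γσ with sat? w σ φ
  ... | yes _ = ↭-refl
  ... | no ¬φ = contradiction (⊢-sound ⊢φ m w σ Γσ) ¬φ
  soundᶜ (C9 {φ = φ} d e) m w σ Γσ with sat? w σ φ
  ... | yes φσ = soundᶜ d m w σ (φσ ∷ Γσ)
  ... | no ¬φσ = soundᶜ e m w σ (¬φσ ∷ Γσ)
  soundᶜ (C10 {φ = φ}) m w σ Γσ with sat? w σ φ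
  ... | yes _ = ↭-refl
  ... | no _ = ↭-refl

-- Automata over marked letters

¬∃¬⇔∀ : ∀ {I : Set} {P Q : I → Set} → (∀ i → Dec (Q i)) → (∀ i → P i ⇔ Q i) →
  (¬ ∃ λ i → ¬ P i) ⇔ (∀ i → Q i)
¬∃¬⇔∀ Q? P⇔Q = mk⇔
  (λ ¬∃ i → decidable-stable (Q? i) λ ¬q → ¬∃ (i , ¬q ∘ to (P⇔Q i)))
  (λ ∀q (i , ¬p) → ¬p (from (P⇔Q i) (∀q i)))

encodeSubset : ∀ {n} → Subset n → Fin (2 ^ n)
encodeSubset []      = Fin.zero
encodeSubset (b ∷ U) = Fin.combine (Inverse.from 2↔Bool b) (encodeSubset U)

decodeSubset : ∀ {n} → Fin (2 ^ n) → Subset n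
decodeSubset {zero}  _ = []
decodeSubset {suc n} c with Fin.remQuot {2} (2 ^ n) c
... | b , c′ = Inverse.to 2↔Bool b ∷ decodeSubset c′

decode-encodeSubset : ∀ {n} (U : Subset n) → decodeSubset (encodeSubset U) ≡ U
decode-encodeSubset []      = refl
decode-encodeSubset {suc n} (b ∷ U) = ≡.trans
  (cong (λ (c , c′) → Inverse.to 2↔Bool c ∷ decodeSubset c′)
        (remQuot-combine {k = 2 ^ n} (Inverse.from 2↔Bool b) (encodeSubset U)))
  (cong₂ _∷_ (Inverse.strictlyInverseˡ 2↔Bool b) (decode-encodeSubset U))

subsetOf : ∀ {n} {P : Fin n → Set} → (∀ q → Dec (P q)) → Subset n
subsetOf P? = tabulate (does ∘ P?)

∈-subsetOf : ∀ {n} {P : Fin n → Set} (P? : ∀ q → Dec (P q)) q → q Subset.∈ subsetOf P? ⇔ P q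
∈-subsetOf P? q = ⇔.trans (mk⇔ Vec.[]=⇒lookup (Vec.lookup⇒[]= q _))
  (⇔.trans (subst-⇔ (_≡ true) (Vec.lookup∘tabulate (does ∘ P?) q)) (does-true⇔ (P? q)))
  where
  does-true⇔ : ∀ {A : Set} (A? : Dec A) → does A? ≡ true ⇔ A
  does-true⇔ (yes a) = mk⇔ (λ _ → a) (λ _ → refl)
  does-true⇔ (no ¬a) = mk⇔ (λ ()) (λ a → contradiction a ¬a)

∃-Bool? : ∀ {P : Bool → Set} → (∀ b → Dec (P b)) → Dec (∃ P)
∃-Bool? P? with P? false | P? true
... | yes p | _     = yes (false , p)
... | no _  | yes p = yes (true , p)
... | no ¬f | no ¬t = no λ { (false , p) → ¬f p ; (true , p) → ¬t p }

∃-Vec? : ∀ {k} m {P : Vec (Fin k) m → Set} → (∀ v → Dec (P v)) → Dec (∃ P)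
∃-Vec? zero    P? = Dec.map′ ([] ,_) (λ { ([] , p) → p }) (P? [])
∃-Vec? (suc m) P? = Dec.map′ (λ (a , v , p) → a ∷ v , p) (λ { (a ∷ v , p) → a , v , p })
  (any? λ a → ∃-Vec? m (P? ∘ (a ∷_)))

module Pumping {A : Set} {N : ℕ} (δ : Fin N → A → Fin N) where

  -- Among the first N + 1 prefixes two reach the same state; the segment between them is a loop.
  cut-loop : ∀ q (as : List A) → N ≤ length as →
    ∃ λ bs → length bs < length as × foldl δ q bs ≡ foldl δ q as
  cut-loop q as N≤∣as∣ with pigeonhole (ℕ.n<1+n N) (λ i → foldl δ q (take (Fin.toℕ i) as))
  ... | i , j , i<j , same-state = take i′ as ++ drop j′ as , shorter , same-end
    where
    i′ j′ : ℕ
    i′ = Fin.toℕ i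
    j′ = Fin.toℕ j
    j≤∣as∣ : j′ ≤ length as
    j≤∣as∣ = ℕ.≤-trans (ℕ.≤-pred (toℕ<n j)) N≤∣as∣
    shorter : length (take i′ as ++ drop j′ as) < length as
    shorter = begin-strict
      length (take i′ as ++ drop j′ as)         ≡⟨ List.length-++ (take i′ as) ⟩
      length (take i′ as) + length (drop j′ as) ≡⟨ cong₂ _+_
        (≡.trans (List.length-take i′ as) (ℕ.m≤n⇒m⊓n≡m (ℕ.<⇒≤ (ℕ.<-≤-trans i<j j≤∣as∣))))
        (List.length-drop j′ as) ⟩
      i′ + (length as ∸ j′)                     <⟨ ℕ.+-monoˡ-< (length as ∸ j′) i<j ⟩
      j′ + (length as ∸ j′)                     ≡⟨ ℕ.m+[n∸m]≡n j≤∣as∣ ⟩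
      length as                                 ∎
      where open ℕ.≤-Reasoning
    same-end : foldl δ q (take i′ as ++ drop j′ as) ≡ foldl δ q as
    same-end = begin
      foldl δ q (take i′ as ++ drop j′ as)          ≡⟨ List.foldl-++ δ q (take i′ as) _ ⟩
      foldl δ (foldl δ q (take i′ as)) (drop j′ as) ≡⟨ cong (λ s → foldl δ s (drop j′ as)) same-state ⟩
      foldl δ (foldl δ q (take j′ as)) (drop j′ as) ≡⟨ List.foldl-++ δ q (take j′ as) _ ⟨
      foldl δ q (take j′ as ++ drop j′ as)          ≡⟨ cong (foldl δ q) (List.take++drop≡id j′ as) ⟩
      foldl δ q as                                  ∎
      where open ≡.≡-Reasoning

  short-word : ∀ q (as : List A) → ∃ λ bs → length bs < N × foldl δ q bs ≡ foldl δ q as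
  short-word q as = <-rec (λ ℓ → ∀ as → length as ≡ ℓ → Short as) shorten (length as) as refl
    where
    Short : List A → Set
    Short as = ∃ λ bs → length bs < N × foldl δ q bs ≡ foldl δ q as
    shorten : ∀ ℓ → (∀ {ℓ′} → ℓ′ < ℓ → ∀ as → length as ≡ ℓ′ → Short as) → ∀ as → length as ≡ ℓ → Short as
    shorten ℓ rec as refl with length as <? N
    ... | yes ∣as∣<N = as , ∣as∣<N , refl
    ... | no ∣as∣≮N with cut-loop q as (ℕ.≮⇒≥ ∣as∣≮N)
    ... | bs , shorter , same with rec shorter bs refl
    ... | cs , ∣cs∣<N , same′ = cs , ∣cs∣<N , ≡.trans same′ same

module _ {k N : ℕ} (δ : Fin N → Fin k → Fin N) where

  reachable? : ∀ {F : Fin N → Set} → (∀ q → Dec (F q)) → ∀ q → Dec (∃ λ as → F (foldl δ q as))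
  reachable? {F} F? q = Dec.map′
    (λ (_ , _ , v , f) → Vec.toList v , f)
    (λ (as , f) → case Pumping.short-word δ q as of λ where
      (bs , ∣bs∣<N , same) → length bs , ∣bs∣<N , Vec.fromList bs ,
        subst F (≡.sym (≡.trans (cong (foldl δ q) (Vec.toList∘fromList bs)) same)) f)
    (ℕ.anyUpTo? (λ m → ∃-Vec? m (λ v → F? (foldl δ q (Vec.toList v)))) N)

record Letter (k : ℕ) : Set where
  constructor letter
  field
    symbol  : Fin k
    fo-mark : FOVar → Bool
    so-mark : SOVar → Bool
open Letter

run : ∀ {Q A : Set} → (Q → A → Q) → Q → ∀ {n} → (Fin n → A) → Q
run δ q {zero}  L = q
run δ q {suc n} L = run δ (δ q (L Fin.zero)) (L ∘ Fin.suc)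

run-× : ∀ {Q Q′ A : Set} (δ : Q → A → Q) (δ′ : Q′ → A → Q′) q q′ {n} (L : Fin n → A) →
  run (λ (s , s′) a → δ s a , δ′ s′ a) (q , q′) L ≡ (run δ q L , run δ′ q′ L)
run-× δ δ′ q q′ {zero}  L = refl
run-× δ δ′ q q′ {suc n} L = run-× δ δ′ _ _ (L ∘ Fin.suc)

module Coding {S : Set} {N : ℕ} (code : S → Fin N) (decode : Fin N → S)
              (decode-code : ∀ s → decode (code s) ≡ s) where

  coded : ∀ {A : Set} → (S → A → S) → Fin N → A → Fin N
  coded δ c a = code (δ (decode c) a)

  decode-run : ∀ {A : Set} (δ : S → A → S) c {n} (L : Fin n → A) →
    decode (run (coded δ) c L) ≡ run δ (decode c) L
  decode-run δ c {zero}  L = refl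
  decode-run δ c {suc n} L =
    ≡.trans (decode-run δ _ (L ∘ Fin.suc)) (cong (λ s → run δ s (L ∘ Fin.suc)) (decode-code _))

module PairCoding (m n : ℕ) =
  Coding {Fin m × Fin n} (uncurry Fin.combine) (Fin.remQuot n) (uncurry remQuot-combine)

module _ {k : ℕ} where

  -- Letters carry functions, so they are compared pointwise.
  infix 4 _≋_
  _≋_ : Letter k → Letter k → Set
  ℓ ≋ ℓ′ = symbol ℓ ≡ symbol ℓ′ × (∀ x → fo-mark ℓ x ≡ fo-mark ℓ′ x) × (∀ X → so-mark ℓ X ≡ so-mark ℓ′ X)

  letterAt : ∀ {n} → Vec (Fin k) n → Val n → Fin n → Letter k
  letterAt w σ p = letter (lookup w p) (λ x → does (fo σ x Fin.≟ p)) (λ X → lookup (so σ X) p)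

  _[_≔¹_] : Letter k → FOVar → Bool → Letter k
  ℓ [ x ≔¹ b ] = record ℓ { fo-mark = λ y → if does (y ≟ x) then b else fo-mark ℓ y }

  _[_≔²_] : Letter k → SOVar → Bool → Letter k
  ℓ [ X ≔² b ] = record ℓ { so-mark = λ Y → if does (Y ≟ X) then b else so-mark ℓ Y }

  ≔¹-resp : ∀ x b {ℓ ℓ′} → ℓ ≋ ℓ′ → ℓ [ x ≔¹ b ] ≋ ℓ′ [ x ≔¹ b ]
  ≔¹-resp x b (s , f , g) = s , (λ y → cong (if_then_else_ _ b) (f y)) , g

  ≔²-resp : ∀ X b {ℓ ℓ′} → ℓ ≋ ℓ′ → ℓ [ X ≔² b ] ≋ ℓ′ [ X ≔² b ]
  ≔²-resp X b (s , f , g) = s , f , (λ Y → cong (if_then_else_ _ b) (g Y))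

  record DFA : Set₁ where
    field
      size      : ℕ
      start     : Fin size
      step      : Fin size → Letter k → Fin size
      step-resp : ∀ q {ℓ ℓ′} → ℓ ≋ ℓ′ → step q ℓ ≡ step q ℓ′
      Final     : Fin size → Set
      final?    : ∀ q → Dec (Final q)

    Accepts : ∀ {n} → (Fin n → Letter k) → Set
    Accepts L = Final (run step start L)

    run-resp : ∀ q {n} {L L′ : Fin n → Letter k} → (∀ p → L p ≋ L′ p) → run step q L ≡ run step q L′
    run-resp q {zero}  L≋L′ = refl
    run-resp q {suc n} L≋L′ rewrite step-resp q (L≋L′ Fin.zero) = run-resp _ (L≋L′ ∘ Fin.suc)

    Accepts-resp : ∀ {n} {L L′ : Fin n → Letter k} → (∀ p → L p ≋ L′ p) → Accepts L ⇔ Accepts L′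
    Accepts-resp L≋L′ = subst-⇔ Final (run-resp start L≋L′)

  open DFA

  Recognises : DFA → MSO k → Set
  Recognises A φ = ∀ {n} (w : Vec (Fin k) n) (σ : Val n) → Accepts A (letterAt w σ) ⇔ Sat w σ φ

  accept-all : DFA
  accept-all = record
    { size = 1 ; start = Fin.zero ; step = λ q _ → q ; step-resp = λ _ _ → refl
    ; Final = λ _ → ⊤ ; final? = λ _ → yes tt }

  complement : DFA → DFA
  complement A = record A { Final = ¬_ ∘ Final A ; final? = ¬? ∘ final? A }

  infixr 7 _⊗_
  _⊗_ : DFA → DFA → DFA
  A ⊗ B = record
    { size      = size A * size B
    ; start     = Fin.combine (start A) (start B)
    ; step      = coded λ (p , q) ℓ → step A p ℓ , step B q ℓ
    ; step-resp = λ c ℓ≋ℓ′ → cong (uncurry Fin.combine) (cong₂ _,_ (step-resp A _ ℓ≋ℓ′) (step-resp B _ ℓ≋ℓ′))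
    ; Final     = λ c → Final A (proj₁ (unpair c)) × Final B (proj₂ (unpair c))
    ; final?    = λ c → final? A _ ×-dec final? B _ }
    where
    open PairCoding (size A) (size B)
    unpair : Fin (size A * size B) → Fin (size A) × Fin (size B)
    unpair = Fin.remQuot (size B)

  ⊗-accepts : ∀ A B {n} (L : Fin n → Letter k) → Accepts (A ⊗ B) L ⇔ (Accepts A L × Accepts B L)
  ⊗-accepts A B L = subst-⇔ (λ (p , q) → Final A p × Final B q) (≡.trans
    (decode-run _ (Fin.combine (start A) (start B)) L)
    (≡.trans (cong (λ s → run _ s L) (remQuot-combine (start A) (start B)))
             (run-× (step A) (step B) (start A) (start B) L)))
    where open PairCoding (size A) (size B)

  module FirstMatch (trigger : Letter k → Bool) (Test : Letter k → Set) (test? : ∀ ℓ → Dec (Test ℓ))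
                    (trigger-resp : ∀ {ℓ ℓ′} → ℓ ≋ ℓ′ → trigger ℓ ≡ trigger ℓ′)
                    (Test-resp : ∀ {ℓ ℓ′} → ℓ ≋ ℓ′ → Test ℓ ⇔ Test ℓ′) where

    -- 0F: no trigger seen yet; 1F, 2F: the first trigger passed, resp. failed, the test.
    verdict : Letter k → Fin 3
    verdict ℓ = Fin.suc (if does (test? ℓ) then 0F else 1F)

    δ : Fin 3 → Letter k → Fin 3
    δ 0F          ℓ = if trigger ℓ then verdict ℓ else 0F
    δ (Fin.suc q) ℓ = Fin.suc q

    dfa : DFA
    dfa = record
      { size = 3 ; start = 0F ; step = δ ; step-resp = δ-resp ; Final = _≡ 1F ; final? = Fin._≟ 1F }
      where
      δ-resp : ∀ q {ℓ ℓ′} → ℓ ≋ ℓ′ → δ q ℓ ≡ δ q ℓ′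
      δ-resp 0F ℓ≋ℓ′ = cong₂ (if_then_else 0F) (trigger-resp ℓ≋ℓ′)
        (cong (λ b → Fin.suc (if b then 0F else 1F)) (does-⇔ (Test-resp ℓ≋ℓ′) (test? _) (test? _)))
      δ-resp (Fin.suc q) _ = refl

    run-verdict : ∀ {n} (L : Fin n → Letter k) i → trigger (L i) ≡ true →
      (∀ p → p Fin.< i → trigger (L p) ≡ false) → run δ 0F L ≡ verdict (L i)
    run-verdict L 0F first _ rewrite first = decided (L ∘ Fin.suc)
      where
      decided : ∀ {q n} (L : Fin n → Letter k) → run δ (Fin.suc q) L ≡ Fin.suc q
      decided {n = zero} L = refl
      decided {n = suc n} L = decided (L ∘ Fin.suc)
    run-verdict L (Fin.suc i) first none rewrite none 0F (s≤s z≤n) =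
      run-verdict (L ∘ Fin.suc) i first (λ p p<i → none (Fin.suc p) (s≤s p<i))

    accepts : ∀ {n} (L : Fin n → Letter k) i → trigger (L i) ≡ true →
      (∀ p → p Fin.< i → trigger (L p) ≡ false) → Accepts dfa L ⇔ Test (L i)
    accepts L i first none rewrite run-verdict L i first none with test? (L i)
    ... | yes t = mk⇔ (λ _ → t) (λ _ → refl)
    ... | no ¬t = mk⇔ (λ ()) (λ t → contradiction t ¬t)

  module _ {n : ℕ} (w : Vec (Fin k) n) (σ : Val n) (x : FOVar) where

    marked-at : fo-mark (letterAt w σ (fo σ x)) x ≡ true
    marked-at = dec-true (fo σ x Fin.≟ fo σ x) refl

    unmarked-at : ∀ p → fo σ x ≢ p → fo-mark (letterAt w σ p) x ≡ false
    unmarked-at p = dec-false (fo σ x Fin.≟ p)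

    unmarked-before : ∀ p → p Fin.< fo σ x → fo-mark (letterAt w σ p) x ≡ false
    unmarked-before p p<x = unmarked-at p (<⇒≢ p<x ∘ ≡.sym)

  module AtomP (a : Fin k) (x : FOVar) = FirstMatch (λ ℓ → fo-mark ℓ x) (λ ℓ → symbol ℓ ≡ a)
    (λ ℓ → symbol ℓ Fin.≟ a) (λ (_ , f , _) → f x) (λ (s , _ , _) → subst-⇔ (_≡ a) s)

  atomP-recognises : ∀ a x → Recognises (AtomP.dfa a x) (P a x)
  atomP-recognises a x w σ = AtomP.accepts a x (letterAt w σ) (fo σ x)
    (marked-at w σ x) (unmarked-before w σ x)

  module AtomIn (x : FOVar) (X : SOVar) = FirstMatch (λ ℓ → fo-mark ℓ x) (λ ℓ → so-mark ℓ X ≡ true)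
    (λ ℓ → so-mark ℓ X Bool.≟ true) (λ (_ , f , _) → f x) (λ (_ , _ , g) → subst-⇔ (_≡ true) (g X))

  atomIn-recognises : ∀ x X → Recognises (AtomIn.dfa x X) (x ∈ᴹ X)
  atomIn-recognises x X w σ = ⇔.trans
    (AtomIn.accepts x X (letterAt w σ) (fo σ x) (marked-at w σ x) (unmarked-before w σ x))
    (mk⇔ (Vec.lookup⇒[]= (fo σ x) (so σ X)) Vec.[]=⇒lookup)

  module AtomLe (x y : FOVar) = FirstMatch (λ ℓ → fo-mark ℓ x ∨ fo-mark ℓ y) (λ ℓ → fo-mark ℓ x ≡ true)
    (λ ℓ → fo-mark ℓ x Bool.≟ true) (λ (_ , f , _) → cong₂ _∨_ (f x) (f y))
    (λ (_ , f , _) → subst-⇔ (_≡ true) (f x))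

  -- Both marks are searched for at once: the first one found is x's iff x ≤ y.
  atomLe-recognises : ∀ x y → Recognises (AtomLe.dfa x y) (x ≤ᴹ y)
  atomLe-recognises x y w σ with fo σ x Fin.≤? fo σ y
  ... | yes x≤y = ⇔.trans
    (AtomLe.accepts x y (letterAt w σ) (fo σ x)
      (cong (_∨ fo-mark (letterAt w σ (fo σ x)) y) (marked-at w σ x)) neither)
    (mk⇔ (λ _ → x≤y) (λ _ → marked-at w σ x))
    where
    neither : ∀ p → p Fin.< fo σ x → fo-mark (letterAt w σ p) x ∨ fo-mark (letterAt w σ p) y ≡ false
    neither p p<x = cong₂ _∨_ (unmarked-before w σ x p p<x)
                              (unmarked-before w σ y p (ℕ.<-≤-trans p<x x≤y))
  ... | no x≰y = ⇔.trans
    (AtomLe.accepts x y (letterAt w σ) (fo σ y)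
      (≡.trans (cong (fo-mark (letterAt w σ (fo σ y)) x ∨_) (marked-at w σ y)) (Bool.∨-zeroʳ _)) neither)
    (mk⇔ (λ x-at-y → contradiction x-at-y x-not-at-y) (λ x≤y → contradiction x≤y x≰y))
    where
    y<x : fo σ y Fin.< fo σ x
    y<x = ℕ.≰⇒> x≰y
    x-not-at-y : ¬ fo-mark (letterAt w σ (fo σ y)) x ≡ true
    x-not-at-y e = contradiction (≡.trans (≡.sym e) (unmarked-at w σ x (fo σ y) (<⇒≢ y<x ∘ ≡.sym))) λ ()
    neither : ∀ p → p Fin.< fo σ y → fo-mark (letterAt w σ p) x ∨ fo-mark (letterAt w σ p) y ≡ false
    neither p p<y = cong₂ _∨_ (unmarked-before w σ x p (ℕ.<-trans p<y y<x)) (unmarked-before w σ y p p<y)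

  -- Subset construction for the automaton that reads each letter ℓ as override b ℓ for a guessed bit b.
  module Projection (A : DFA) (override : Bool → Letter k → Letter k)
                    (override-resp : ∀ b {ℓ ℓ′} → ℓ ≋ ℓ′ → override b ℓ ≋ override b ℓ′) where

    guessed : ∀ {n} → (Fin n → Letter k) → (Fin n → Bool) → Fin n → Letter k
    guessed L bits p = override (bits p) (L p)

    Succ : Subset (size A) → Letter k → Fin (size A) → Set
    Succ U ℓ q′ = ∃ λ q → q Subset.∈ U × ∃ λ b → step A q (override b ℓ) ≡ q′

    Succ? : ∀ U ℓ q′ → Dec (Succ U ℓ q′)
    Succ? U ℓ q′ = any? λ q → q Subset.∈? U ×-dec ∃-Bool? λ b → step A q (override b ℓ) Fin.≟ q′

    post : Subset (size A) → Letter k → Subset (size A)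
    post U ℓ = subsetOf (Succ? U ℓ)

    ∈-post : ∀ U ℓ q′ → q′ Subset.∈ post U ℓ ⇔ Succ U ℓ q′
    ∈-post U ℓ = ∈-subsetOf (Succ? U ℓ)

    post-resp : ∀ U {ℓ ℓ′} → ℓ ≋ ℓ′ → post U ℓ ≡ post U ℓ′
    post-resp U {ℓ} {ℓ′} ℓ≋ℓ′ = Vec.tabulate-cong λ q′ → does-⇔ (mk⇔
      (λ (q , q∈U , b , e) → q , q∈U , b , ≡.trans (≡.sym (same q b)) e)
      (λ (q , q∈U , b , e) → q , q∈U , b , ≡.trans (same q b) e)) (Succ? U ℓ q′) (Succ? U ℓ′ q′)
      where
      same : ∀ q b → step A q (override b ℓ) ≡ step A q (override b ℓ′)
      same q b = step-resp A q (override-resp b ℓ≋ℓ′)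

    ∈-run-post : ∀ {n} (L : Fin n → Letter k) U q → q Subset.∈ run post U L ⇔
      (∃ λ q₀ → q₀ Subset.∈ U × ∃ λ bits → run (step A) q₀ (guessed L bits) ≡ q)
    ∈-run-post {zero} L U q = mk⇔ (λ q∈U → q , q∈U , (λ ()) , refl) λ { (_ , q∈U , _ , refl) → q∈U }
    ∈-run-post {suc n} L U q = mk⇔ forward backward
      where
      Reached : Subset (size A) → ∀ {m} → (Fin m → Letter k) → Set
      Reached U L = ∃ λ q₀ → q₀ Subset.∈ U × ∃ λ bits → run (step A) q₀ (guessed L bits) ≡ q
      IH : q Subset.∈ run post (post U (L 0F)) (L ∘ Fin.suc) ⇔ Reached (post U (L 0F)) (L ∘ Fin.suc)
      IH = ∈-run-post (L ∘ Fin.suc) (post U (L 0F)) q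
      forward : q Subset.∈ run post (post U (L 0F)) (L ∘ Fin.suc) → Reached U L
      forward q∈ with to IH q∈
      ... | q₁ , q₁∈ , bits , e with to (∈-post U (L Fin.zero) q₁) q₁∈
      ... | q₀ , q₀∈U , b , refl = q₀ , q₀∈U , b ◂ bits , e
      backward : Reached U L → q Subset.∈ run post (post U (L 0F)) (L ∘ Fin.suc)
      backward (q₀ , q₀∈U , bits , e) = from IH
        (_ , from (∈-post U (L Fin.zero) _) (q₀ , q₀∈U , bits Fin.zero , refl) , bits ∘ Fin.suc , e)

    dfa : DFA
    dfa = record
      { size      = 2 ^ size A
      ; start     = encodeSubset Subset.⁅ start A ⁆
      ; step      = coded post
      ; step-resp = λ c ℓ≋ℓ′ → cong encodeSubset (post-resp (decodeSubset c) ℓ≋ℓ′)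
      ; Final     = λ c → ∃ λ q → q Subset.∈ decodeSubset c × Final A q
      ; final?    = λ c → any? λ q → q Subset.∈? decodeSubset c ×-dec final? A q }
      where open Coding encodeSubset decodeSubset decode-encodeSubset

    accepts : ∀ {n} (L : Fin n → Letter k) → Accepts dfa L ⇔ ∃ λ bits → Accepts A (guessed L bits)
    accepts L = ⇔.trans (subst-⇔ (λ U → ∃ λ q → q Subset.∈ U × Final A q) reachable) (mk⇔
      (λ (q , q∈ , final) → case to (∈-run-post L _ q) q∈ of λ where
         (q₀ , q₀∈ , bits , e) → bits , subst (λ q₀ → Final A (run (step A) q₀ (guessed L bits)))
                                          (x∈⁅y⁆⇒x≡y _ q₀∈) (subst (Final A) (≡.sym e) final))
      (λ (bits , final) → _ , from (∈-run-post L _ _) (start A , x∈⁅x⁆ (start A) , bits , refl) , final))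
      where
      open Coding encodeSubset decodeSubset decode-encodeSubset
      reachable : decodeSubset (run (coded post) (encodeSubset Subset.⁅ start A ⁆) L)
                ≡ run post Subset.⁅ start A ⁆ L
      reachable = ≡.trans (decode-run post _ L) (cong (λ U → run post U L) (decode-encodeSubset _))

  run-∘ : ∀ {Q A B : Set} (δ : Q → B → Q) (f : A → B) q {n} (L : Fin n → A) →
    run (λ q a → δ q (f a)) q L ≡ run δ q (f ∘ L)
  run-∘ δ f q {zero}  L = refl
  run-∘ δ f q {suc n} L = run-∘ δ f _ (L ∘ Fin.suc)

  -- the number of marks read so far, capped at 2
  count : Fin 3 → Bool → Fin 3
  count 0F false = 0F
  count 0F true  = 1F
  count 1F false = 1F
  count _  _     = 2F

  count-from-2 : ∀ {n} (m : Fin n → Bool) → run count 2F m ≡ 2F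
  count-from-2 {zero}  m = refl
  count-from-2 {suc n} m = count-from-2 (m ∘ Fin.suc)

  count-from-1 : ∀ {n} (m : Fin n → Bool) → run count 1F m ≡ 1F ⇔ (∀ p → m p ≡ false)
  count-from-1 {zero}  m = mk⇔ (λ _ ()) (λ _ → refl)
  count-from-1 {suc n} m with m 0F in m₀
  ... | true  = mk⇔ (λ e → contradiction (≡.trans (≡.sym (count-from-2 (m ∘ Fin.suc))) e) λ ())
                    (λ none → contradiction (≡.trans (≡.sym m₀) (none 0F)) λ ())
  ... | false = ⇔.trans (count-from-1 (m ∘ Fin.suc)) (mk⇔ (∀-cons m₀) (_∘ Fin.suc))

  count-from-0 : ∀ {n} (m : Fin n → Bool) → run count 0F m ≡ 1F ⇔ ∃ λ i → ∀ p → m p ≡ does (i Fin.≟ p)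
  count-from-0 {zero}  m = mk⇔ (λ ()) (λ ())
  count-from-0 {suc n} m with m 0F in m₀
  ... | true  = ⇔.trans (count-from-1 (m ∘ Fin.suc)) (mk⇔ (λ none → 0F , ∀-cons m₀ none) λ where
                  (0F , h) → h ∘ Fin.suc
                  (Fin.suc i , h) → contradiction (≡.trans (≡.sym m₀) (h 0F)) λ ())
  ... | false = ⇔.trans (count-from-0 (m ∘ Fin.suc)) (mk⇔ (λ (i , h) → Fin.suc i , ∀-cons m₀ h) λ where
                  (0F , h) → contradiction (≡.trans (≡.sym m₀) (h 0F)) λ ()
                  (Fin.suc i , h) → i , h ∘ Fin.suc)

  once : FOVar → DFA
  once x = record
    { size = 3 ; start = 0F ; step = λ q ℓ → count q (fo-mark ℓ x)
    ; step-resp = λ q (_ , f , _) → cong (count q) (f x) ; Final = _≡ 1F ; final? = Fin._≟ 1F }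

  once-accepts : ∀ x {n} (L : Fin n → Letter k) →
    Accepts (once x) L ⇔ ∃ λ i → ∀ p → fo-mark (L p) x ≡ does (i Fin.≟ p)
  once-accepts x L = ⇔.trans (subst-⇔ (_≡ 1F) (run-∘ count (λ ℓ → fo-mark ℓ x) 0F L))
                             (count-from-0 (λ p → fo-mark (L p) x))

  module _ {n : ℕ} (w : Vec (Fin k) n) (σ : Val n) where

    letterAt-↦¹ : ∀ x i (bits : Fin n → Bool) → (∀ p → bits p ≡ does (i Fin.≟ p)) →
      ∀ p → letterAt w σ p [ x ≔¹ bits p ] ≋ letterAt w (σ [ x ↦¹ i ]) p
    letterAt-↦¹ x i bits bits≗ p = refl , fo-marks , (λ _ → refl)
      where
      fo-marks : ∀ y → fo-mark (letterAt w σ p [ x ≔¹ bits p ]) y ≡ fo-mark (letterAt w (σ [ x ↦¹ i ]) p) y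
      fo-marks y = ≡.trans (cong (λ b → if does (y ≟ x) then b else _) (bits≗ p))
                           (≡.sym (Bool.if-float (λ j → does (j Fin.≟ p)) (does (y ≟ x))))

    letterAt-↦² : ∀ X S (bits : Fin n → Bool) → (∀ p → lookup S p ≡ bits p) →
      ∀ p → letterAt w σ p [ X ≔² bits p ] ≋ letterAt w (σ [ X ↦² S ]) p
    letterAt-↦² X S bits S≗ p = refl , (λ _ → refl) , so-marks
      where
      so-marks : ∀ Y → so-mark (letterAt w σ p [ X ≔² bits p ]) Y ≡ so-mark (letterAt w (σ [ X ↦² S ]) p) Y
      so-marks Y = ≡.trans (cong (λ b → if does (Y ≟ X) then b else _) (≡.sym (S≗ p)))
                           (≡.sym (Bool.if-float (λ U → lookup U p) (does (Y ≟ X))))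

  existsSO : SOVar → DFA → DFA
  existsSO X A = Projection.dfa A (λ b ℓ → ℓ [ X ≔² b ]) (≔²-resp X)

  existsSO-accepts : ∀ X A {n} (w : Vec (Fin k) n) (σ : Val n) →
    Accepts (existsSO X A) (letterAt w σ) ⇔ ∃ λ S → Accepts A (letterAt w (σ [ X ↦² S ]))
  existsSO-accepts X A w σ =
    ⇔.trans (Projection.accepts A (λ b ℓ → ℓ [ X ≔² b ]) (≔²-resp X) (letterAt w σ)) (mk⇔
    (λ (bits , acc) → tabulate bits ,
       to (Accepts-resp A (letterAt-↦² w σ X (tabulate bits) bits (Vec.lookup∘tabulate bits))) acc)
    (λ (S , acc) → lookup S , from (Accepts-resp A (letterAt-↦² w σ X S (lookup S) (λ _ → refl))) acc))

  existsFO : FOVar → DFA → DFA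
  existsFO x A = Projection.dfa (A ⊗ once x) (λ b ℓ → ℓ [ x ≔¹ b ]) (≔¹-resp x)

  existsFO-accepts : ∀ x A {n} (w : Vec (Fin k) n) (σ : Val n) →
    Accepts (existsFO x A) (letterAt w σ) ⇔ ∃ λ i → Accepts A (letterAt w (σ [ x ↦¹ i ]))
  existsFO-accepts x A w σ =
    ⇔.trans (Projection.accepts (A ⊗ once x) (λ b ℓ → ℓ [ x ≔¹ b ]) (≔¹-resp x) (letterAt w σ)) (mk⇔
    (λ (bits , acc) → case to (⊗-accepts A (once x) (guessed bits)) acc of λ where
      (accA , accOnce) → case to (once-accepts x (guessed bits)) accOnce of λ where
        (i , marks) → i , to (Accepts-resp A (letterAt-↦¹ w σ x i bits (λ p →
                                ≡.trans (≡.sym (mark-x p (bits p))) (marks p)))) accA)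
    (λ (i , acc) → at i , from (⊗-accepts A (once x) (guessed (at i)))
      ( from (Accepts-resp A (letterAt-↦¹ w σ x i (at i) (λ _ → refl))) acc
      , from (once-accepts x (guessed (at i))) (i , λ p → mark-x p (at i p)))))
    where
    guessed : (Fin _ → Bool) → Fin _ → Letter k
    guessed bits p = letterAt w σ p [ x ≔¹ bits p ]
    at : Fin _ → Fin _ → Bool
    at i p = does (i Fin.≟ p)
    mark-x : ∀ p b → fo-mark (letterAt w σ p [ x ≔¹ b ]) x ≡ b
    mark-x p b = if-yes (x ≟ x) refl

  automaton : MSO k → DFA
  automaton ⊤ᴹ       = accept-all
  automaton (P a x)  = AtomP.dfa a x
  automaton (x ≤ᴹ y) = AtomLe.dfa x y
  automaton (x ∈ᴹ X) = AtomIn.dfa x X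
  automaton (¬ᴹ φ)   = complement (automaton φ)
  automaton (φ ∧ᴹ ψ) = automaton φ ⊗ automaton ψ
  automaton (∀¹ x φ) = complement (existsFO x (complement (automaton φ)))
  automaton (∀² X φ) = complement (existsSO X (complement (automaton φ)))

  automaton-recognises : ∀ φ → Recognises (automaton φ) φ
  automaton-recognises ⊤ᴹ       w σ = mk⇔ (λ _ → tt) (λ _ → tt)
  automaton-recognises (P a x)  = atomP-recognises a x
  automaton-recognises (x ≤ᴹ y) = atomLe-recognises x y
  automaton-recognises (x ∈ᴹ X) = atomIn-recognises x X
  automaton-recognises (¬ᴹ φ)   w σ = ¬-cong-⇔ (automaton-recognises φ w σ)
  automaton-recognises (φ ∧ᴹ ψ) w σ = ⇔.trans (⊗-accepts (automaton φ) (automaton ψ) (letterAt w σ))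
    (automaton-recognises φ w σ ×-⇔ automaton-recognises ψ w σ)
  automaton-recognises (∀¹ x φ) w σ = ⇔.trans (¬-cong-⇔ (existsFO-accepts x (complement (automaton φ)) w σ))
    (¬∃¬⇔∀ (λ i → sat? w (σ [ x ↦¹ i ]) φ) (λ i → automaton-recognises φ w (σ [ x ↦¹ i ])))
  automaton-recognises (∀² X φ) w σ = ⇔.trans (¬-cong-⇔ (existsSO-accepts X (complement (automaton φ)) w σ))
    (¬∃¬⇔∀ (λ S → sat? w (σ [ X ↦² S ]) φ) (λ S → automaton-recognises φ w (σ [ X ↦² S ])))

  -- Deciding satisfiability

  run-lookup : ∀ {Q A : Set} (δ : Q → A → Q) q {m} (v : Vec A m) →
    run δ q (lookup v) ≡ foldl δ q (Vec.toList v)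
  run-lookup δ q []      = refl
  run-lookup δ q (a ∷ v) = run-lookup δ (δ q a) v

  origin : ∀ {m} → Val (suc m)
  origin = val (λ _ → 0F) (λ _ → Subset.⊥)

  module _ (A : DFA) where

    plain : Fin k → Letter k
    plain c = letter c (λ _ → false) (λ _ → false)

    δ₀ : Fin (size A) → Fin k → Fin (size A)
    δ₀ q c = step A q (plain c)

    initial : Fin k → Fin (size A)
    initial a = step A (start A) (letter a (λ _ → true) (λ _ → false))

    run-origin : ∀ {m} a (v : Vec (Fin k) m) →
      run (step A) (start A) (letterAt (a ∷ v) origin) ≡ foldl δ₀ (initial a) (Vec.toList v)
    run-origin a v = begin
      run (step A) (initial a) (letterAt (a ∷ v) origin ∘ Fin.suc) ≡⟨ run-resp A (initial a) plain-after-first ⟩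
      run (step A) (initial a) (plain ∘ lookup v)                 ≡⟨ run-∘ (step A) plain (initial a) (lookup v) ⟨
      run δ₀ (initial a) (lookup v)                               ≡⟨ run-lookup δ₀ (initial a) v ⟩
      foldl δ₀ (initial a) (Vec.toList v)                         ∎
      where
      open ≡.≡-Reasoning
      plain-after-first : ∀ p → letterAt (a ∷ v) origin (Fin.suc p) ≋ plain (lookup v p)
      plain-after-first p = refl , (λ _ → refl) , (λ _ → Vec.lookup-replicate p false)

    accepts-origin? : Dec (∃ λ m → ∃ λ (w : Vec (Fin k) (suc m)) → Accepts A (letterAt w origin))
    accepts-origin? = Dec.map′
      (λ (a , as , f) → length as , a ∷ Vec.fromList as , subst (Final A)
         (≡.sym (≡.trans (run-origin a (Vec.fromList as)) (cong (foldl δ₀ (initial a)) (Vec.toList∘fromList as)))) f)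
      (λ { (m , a ∷ v , acc) → a , Vec.toList v , subst (Final A) (run-origin a v) acc })
      (any? λ a → reachable? δ₀ (final? A) (initial a))

  Satisfiable : List (MSO k) → Set
  Satisfiable Γ = ∃ λ m → ∃ λ (w : Vec (Fin k) (suc m)) → ∃ λ σ → All (Sat w σ) Γ

  -- Closing off the free variables makes the choice of valuation irrelevant.
  satisfiable? : ∀ Γ → Dec (Satisfiable Γ)
  satisfiable? Γ = Dec.map′
    (λ (m , w , acc) → case closure-elim w B (⋀ Γ) origin (to (automaton-recognises θ w origin) acc) of λ where
       (τ , s) → m , w , τ , to (Sat-⋀ w Γ τ) s)
    (λ (m , w , τ , Γτ) → m , w , from (automaton-recognises θ w origin)
       (closure-intro w B (⋀ Γ) (λ x f B≤x → ⊥-elim (ℕ.<⇒≱ (s≤s (OccFO-≤ (⋀ Γ) (FreeFO⇒OccFO (⋀ Γ) f))) B≤x))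
                                (λ X f B≤X → ⊥-elim (ℕ.<⇒≱ (s≤s (FreeSO-≤ (⋀ Γ) f)) B≤X))
                                (from (Sat-⋀ w Γ τ) Γτ)))
    (accepts-origin? (automaton θ))
    where
    B : ℕ
    B = suc (supᴹ (⋀ Γ))
    θ : MSO k
    θ = closure B (⋀ Γ)

-- Completeness

map-allFin-injective : ∀ {A : Set} {n} (f g : Fin n → A) →
  map f (allFin n) ≡ map g (allFin n) → ∀ i → f i ≡ g i
map-allFin-injective f g same = tabulate-injective (≡.trans (≡.sym (List.map-tabulate id f))
                                                   (≡.trans same (List.map-tabulate id g)))
  where
  tabulate-injective : ∀ {A : Set} {n} {f g : Fin n → A} →
    List.tabulate f ≡ List.tabulate g → ∀ i → f i ≡ g i
  tabulate-injective {n = suc n} e 0F = List.∷-injectiveˡ e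
  tabulate-injective {n = suc n} e (Fin.suc i) = tabulate-injective (List.∷-injectiveʳ e) i

module _ {k : ℕ} {R : Set} where

  supˢ : Step k R → ℕ
  supˢ (wt r)         = 0
  supˢ (φ ?ˢ Ψ₁ ∶ Ψ₂) = supᴹ φ ⊔ (supˢ Ψ₁ ⊔ supˢ Ψ₂)

  OccStep-≤ : ∀ Ψ {x} → OccStep x Ψ → x ≤ supˢ Ψ
  OccStep-≤ (φ ?ˢ Ψ₁ ∶ Ψ₂) (inj₁ o)        = ℕ.m≤n⇒m≤n⊔o _ (OccFO-≤ φ o)
  OccStep-≤ (φ ?ˢ Ψ₁ ∶ Ψ₂) (inj₂ (inj₁ o)) = ℕ.m≤n⇒m≤o⊔n (supᴹ φ) (ℕ.m≤n⇒m≤n⊔o _ (OccStep-≤ Ψ₁ o))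
  OccStep-≤ (φ ?ˢ Ψ₁ ∶ Ψ₂) (inj₂ (inj₂ o)) = ℕ.m≤n⇒m≤o⊔n (supᴹ φ) (ℕ.m≤n⇒m≤o⊔n (supˢ Ψ₁) (OccStep-≤ Ψ₂ o))

  supᶜ : Core k R → ℕ
  supᶜ 𝟎              = 0
  supᶜ (∏ x Ψ)        = supˢ Ψ
  supᶜ (φ ?ᶜ Φ₁ ∶ Φ₂) = supᶜ Φ₁ ⊔ supᶜ Φ₂
  supᶜ (Φ₁ ⊕ Φ₂)      = supᶜ Φ₁ ⊔ supᶜ Φ₂

  leaves : Step k R → List (MSO k × R)
  leaves (wt r)         = (⊤ᴹ , r) ∷ []
  leaves (φ ?ˢ Ψ₁ ∶ Ψ₂) =
    map (Product.map₁ (φ ∧ᴹ_)) (leaves Ψ₁) ++ map (Product.map₁ ((¬ᴹ φ) ∧ᴹ_)) (leaves Ψ₂)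

  leaf-at : ∀ Ψ {n} (w : Vec (Fin k) n) σ →
    ∃ λ ((π , r) : MSO k × R) → (π , r) ∈ leaves Ψ × Sat w σ π × ⟦ Ψ ⟧ˢ w σ ≡ r
  leaf-at (wt r) w σ = (⊤ᴹ , r) , here refl , tt , refl
  leaf-at (φ ?ˢ Ψ₁ ∶ Ψ₂) w σ with sat? w σ φ | leaf-at Ψ₁ w σ | leaf-at Ψ₂ w σ
  ... | yes s | (π , r) , ∈Ψ₁ , π-holds , e | _ =
    (φ ∧ᴹ π , r) , ∈-++⁺ˡ (∈-map⁺ (Product.map₁ (φ ∧ᴹ_)) ∈Ψ₁) , (s , π-holds) , e
  ... | no ¬s | _ | (π , r) , ∈Ψ₂ , π-holds , e =
    ((¬ᴹ φ) ∧ᴹ π , r) , ∈-++⁺ʳ _ (∈-map⁺ (Product.map₁ ((¬ᴹ φ) ∧ᴹ_)) ∈Ψ₂) , (¬s , π-holds) , e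

  leaf-value : ∀ Ψ {π r} → (π , r) ∈ leaves Ψ → ∀ {n} (w : Vec (Fin k) n) σ → Sat w σ π → ⟦ Ψ ⟧ˢ w σ ≡ r
  leaf-value (wt r) (here refl) w σ _ = refl
  leaf-value (φ ?ˢ Ψ₁ ∶ Ψ₂) ∈Ψ w σ π-holds with ∈-++⁻ (map (Product.map₁ (φ ∧ᴹ_)) (leaves Ψ₁)) ∈Ψ
  ... | inj₁ ∈₁ with ∈-map⁻ (Product.map₁ (φ ∧ᴹ_)) ∈₁
  ... | _ , ∈Ψ₁ , refl = ≡.trans (?ˢ-yes w σ (proj₁ π-holds) Ψ₁ Ψ₂) (leaf-value Ψ₁ ∈Ψ₁ w σ (proj₂ π-holds))
  leaf-value (φ ?ˢ Ψ₁ ∶ Ψ₂) ∈Ψ w σ π-holds | inj₂ ∈₂ with ∈-map⁻ (Product.map₁ ((¬ᴹ φ) ∧ᴹ_)) ∈₂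
  ... | _ , ∈Ψ₂ , refl = ≡.trans (?ˢ-no w σ (proj₁ π-holds) Ψ₁ Ψ₂) (leaf-value Ψ₂ ∈Ψ₂ w σ (proj₂ π-holds))

  ∑ : FOVar → List (Step k R) → Core k R
  ∑ z = foldr (λ Ψ Φ → ∏ z Ψ ⊕ Φ) 𝟎

  word : FOVar → Step k R → ∀ {n} → Vec (Fin k) n → Val n → List R
  word z Ψ w σ = map (λ i → ⟦ Ψ ⟧ˢ w (σ [ z ↦¹ i ])) (allFin _)

  ⟦∑⟧ : ∀ z Ψs {n} (w : Vec (Fin k) n) σ → ⟦ ∑ z Ψs ⟧ᶜ w σ ≡ map (λ Ψ → word z Ψ w σ) Ψs
  ⟦∑⟧ z []       w σ = refl
  ⟦∑⟧ z (Ψ ∷ Ψs) w σ = cong (word z Ψ w σ ∷_) (⟦∑⟧ z Ψs w σ)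

  data SumOfProducts : Core k R → Set where
    𝟎   : SumOfProducts 𝟎
    ∏   : ∀ x Ψ → SumOfProducts (∏ x Ψ)
    _⊕_ : ∀ {Φ₁ Φ₂} → SumOfProducts Φ₁ → SumOfProducts Φ₂ → SumOfProducts (Φ₁ ⊕ Φ₂)

  renamed : FOVar → ∀ {Φ} → SumOfProducts Φ → List (Step k R)
  renamed z 𝟎         = []
  renamed z (∏ x Ψ)   = substˢ z x Ψ ∷ []
  renamed z (s₁ ⊕ s₂) = renamed z s₁ ++ renamed z s₂

  conditionals : Core k R → ℕ
  conditionals 𝟎              = 0
  conditionals (∏ x Ψ)        = 0
  conditionals (φ ?ᶜ Φ₁ ∶ Φ₂) = suc (conditionals Φ₁ + conditionals Φ₂)
  conditionals (Φ₁ ⊕ Φ₂)      = conditionals Φ₁ + conditionals Φ₂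

module Completeness {k : ℕ} {R : Set} (_⊢_ : List (MSO k) → MSO k → Set)
                    (⊢-sound-complete : SoundComplete _⊢_) where

  open ProofSystem {k} {R} _⊢_ using () renaming (_⊢ˢ_≈_ to _⊩ˢ_≈_; _⊢ᶜ_≈_ to _⊩ᶜ_≈_)
  open Soundness {k} {R} _⊢_ (proj₁ (⊢-sound-complete _ _))

  ⊢-complete : ∀ {Γ φ} → Γ ⊨ᴹ φ → Γ ⊢ φ
  ⊢-complete = proj₂ (⊢-sound-complete _ _)

  ⊢¬⊤ : ∀ {Γ} → ¬ Satisfiable Γ → Γ ⊢ (¬ᴹ ⊤ᴹ)
  ⊢¬⊤ ¬sat = ⊢-complete λ m w σ Γσ _ → ¬sat (m , w , σ , Γσ)

  -- Ψ₁ ≈ (⊤ ? Ψ₁ : Ψ₂) ≈ (¬⊤ ? Ψ₂ : Ψ₁) ≈ Ψ₂, the last step because the context proves ¬⊤.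
  explosionˢ : ∀ {Γ Ψ₁ Ψ₂} → ¬ Satisfiable Γ → Γ ⊩ˢ Ψ₁ ≈ Ψ₂
  explosionˢ ¬sat = trans (sym (S3 (⊢-complete λ _ _ _ _ → tt))) (trans (sym S2) (S3 (⊢¬⊤ ¬sat)))

  explosionᶜ : ∀ {Γ Φ₁ Φ₂} → ¬ Satisfiable Γ → Γ ⊩ᶜ Φ₁ ≈ Φ₂
  explosionᶜ ¬sat = trans (sym (C8 (⊢-complete λ _ _ _ _ → tt))) (trans (sym C7) (C8 (⊢¬⊤ ¬sat)))

  completeˢ : ∀ Γ Ψ₁ Ψ₂ → Γ ⊨ˢ Ψ₁ ≈ Ψ₂ → Γ ⊩ˢ Ψ₁ ≈ Ψ₂
  completeˢ Γ (φ ?ˢ Ψ₁ ∶ Ψ₂) Ψ h = S4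
    (completeˢ (φ ∷ Γ) Ψ₁ Ψ λ { m w σ (s ∷ Γσ) → ≡.trans (≡.sym (?ˢ-yes w σ s Ψ₁ Ψ₂)) (h m w σ Γσ) })
    (completeˢ (¬ᴹ φ ∷ Γ) Ψ₂ Ψ λ { m w σ (¬s ∷ Γσ) → ≡.trans (≡.sym (?ˢ-no w σ ¬s Ψ₁ Ψ₂)) (h m w σ Γσ) })
  completeˢ Γ (wt r) (φ ?ˢ Ψ₁ ∶ Ψ₂) h = sym (S4
    (sym (completeˢ (φ ∷ Γ) (wt r) Ψ₁ λ { m w σ (s ∷ Γσ) → ≡.trans (h m w σ Γσ) (?ˢ-yes w σ s Ψ₁ Ψ₂) }))
    (sym (completeˢ (¬ᴹ φ ∷ Γ) (wt r) Ψ₂ λ { m w σ (¬s ∷ Γσ) → ≡.trans (h m w σ Γσ) (?ˢ-no w σ ¬s Ψ₁ Ψ₂) })))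
  completeˢ Γ (wt r) (wt r′) h = complete-wt (satisfiable? Γ) h
    where
    complete-wt : Dec (Satisfiable Γ) → Γ ⊨ˢ wt r ≈ wt r′ → Γ ⊩ˢ wt r ≈ wt r′
    complete-wt (yes (m , w , σ , Γσ)) h = subst (λ r′ → Γ ⊩ˢ wt r ≈ wt r′) (h m w σ Γσ) refl
    complete-wt (no ¬sat) _ = explosionˢ ¬sat

  by-cases : ∀ {Γ Φ₁ Φ₂} φ → (φ ∷ Γ) ⊩ᶜ Φ₁ ≈ Φ₂ → ((¬ᴹ φ) ∷ Γ) ⊩ᶜ Φ₁ ≈ Φ₂ → Γ ⊩ᶜ Φ₁ ≈ Φ₂
  by-cases φ d e = trans (sym (C9 refl refl)) (C9 d e)

  ∑-++ : ∀ {Γ} z Ps Qs → Γ ⊩ᶜ ∑ z (Ps ++ Qs) ≈ (∑ z Ps ⊕ ∑ z Qs)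
  ∑-++ z []       Qs = sym (trans C2 C1)
  ∑-++ z (Ψ ∷ Ps) Qs = trans (cong+ refl (∑-++ z Ps Qs)) (sym C3)

  ∑-↭ : ∀ {Γ} z {Ps Qs} → Ps ↭ Qs → Γ ⊩ᶜ ∑ z Ps ≈ ∑ z Qs
  ∑-↭ z ↭.refl = refl
  ∑-↭ z (↭.prep Ψ p) = cong+ refl (∑-↭ z p)
  ∑-↭ z (↭.swap Ψ Ψ′ p) =
    trans (cong+ refl (cong+ refl (∑-↭ z p))) (trans (sym C3) (trans (cong+ C2 refl) C3))
  ∑-↭ z (↭.trans p q) = trans (∑-↭ z p) (∑-↭ z q)

  ∑-renamed : ∀ {Γ Φ} z (sop : SumOfProducts Φ) → supᶜ Φ < z → Γ ⊩ᶜ Φ ≈ ∑ z (renamed z sop)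
  ∑-renamed z 𝟎 _ = refl
  ∑-renamed z (∏ x Ψ) Ψ<z = trans (C5 λ o → ℕ.<⇒≱ Ψ<z (OccStep-≤ Ψ o)) (sym C1)
  ∑-renamed z (s₁ ⊕ s₂) Φ<z =
    trans (cong+ (∑-renamed z s₁ (ℕ.m⊔n<o⇒m<o _ _ Φ<z)) (∑-renamed z s₂ (ℕ.m⊔n<o⇒n<o _ _ Φ<z)))
          (sym (∑-++ z (renamed z s₁) (renamed z s₂)))

  Settles : List (MSO k) → MSO k → Set
  Settles Δ φ = Δ ⊨ᴹ φ ⊎ Δ ⊨ᴹ (¬ᴹ φ)

  LeavesSettled : List (MSO k) → FOVar → Step k R → Step k R → Set
  LeavesSettled Δ z Ψ Ψ′ = ∀ {π r π′ r′} → (π , r) ∈ leaves Ψ → (π′ , r′) ∈ leaves Ψ′ →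
    Settles Δ (∃¹ z (π ∧ᴹ π′))

  -- The pair of leaves holding at τ is settled positively, so it also holds at σ₀ for some
  -- value of z, where the two words agree.
  agree : ∀ {Δ z Ψ Ψ′ m₀} {w₀ : Vec (Fin k) (suc m₀)} {σ₀} → All (Sat w₀ σ₀) Δ →
    word z Ψ w₀ σ₀ ≡ word z Ψ′ w₀ σ₀ → LeavesSettled Δ z Ψ Ψ′ → Δ ⊨ˢ Ψ ≈ Ψ′
  agree {z = z} {Ψ} {Ψ′} {w₀ = w₀} {σ₀} Δσ₀ same-word settled m w τ Δτ
    with leaf-at Ψ w τ | leaf-at Ψ′ w τ
  ... | (π , r) , ∈Ψ , π-holds , Ψ≡r | (π′ , r′) , ∈Ψ′ , π′-holds , Ψ′≡r′
    with settled ∈Ψ ∈Ψ′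
  ... | inj₂ never = contradiction (from (Sat-∃¹ w (π ∧ᴹ π′) τ z) (fo τ z ,
          Sat-resp w (π ∧ᴹ π′) (λ y → ≡.sym (↦¹-self τ z y)) (λ _ → refl) (π-holds , π′-holds)))
          (never m w τ Δτ)
  ... | inj₁ always with to (Sat-∃¹ w₀ (π ∧ᴹ π′) σ₀ z) (always _ w₀ σ₀ Δσ₀)
  ... | i , π-at-i , π′-at-i = begin
    ⟦ Ψ ⟧ˢ w τ                   ≡⟨ Ψ≡r ⟩
    r                            ≡⟨ leaf-value Ψ ∈Ψ w₀ (σ₀ [ z ↦¹ i ]) π-at-i ⟨
    ⟦ Ψ ⟧ˢ w₀ (σ₀ [ z ↦¹ i ])    ≡⟨ map-allFin-injective _ _ same-word i ⟩
    ⟦ Ψ′ ⟧ˢ w₀ (σ₀ [ z ↦¹ i ])   ≡⟨ leaf-value Ψ′ ∈Ψ′ w₀ (σ₀ [ z ↦¹ i ]) π′-at-i ⟩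
    r′                           ≡⟨ Ψ′≡r′ ⟨
    ⟦ Ψ′ ⟧ˢ w τ                  ∎
    where open ≡.≡-Reasoning

  Words↭ : List (MSO k) → FOVar → List (Step k R) → List (Step k R) → Set
  Words↭ Δ z Ps Qs = ∀ m (w : Vec (Fin k) (suc m)) σ → All (Sat w σ) Δ →
    map (λ Ψ → word z Ψ w σ) Ps ↭ map (λ Ψ → word z Ψ w σ) Qs

  -- Each product of Ps is matched with one of Qs showing the same word at a fixed model.
  match : ∀ {Δ} z → All (λ φ → ¬ FreeFO z φ) Δ → Satisfiable Δ → ∀ Ps Qs →
    (∀ {Ψ Ψ′} → Ψ ∈ Ps → Ψ′ ∈ Qs → LeavesSettled Δ z Ψ Ψ′) → Words↭ Δ z Ps Qs →
    Δ ⊩ᶜ ∑ z Ps ≈ ∑ z Qs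
  match z z∉Δ sat [] [] _ _ = refl
  match z z∉Δ (m₀ , w₀ , σ₀ , Δσ₀) [] (_ ∷ _) _ h = contradiction (↭.↭-length (h m₀ w₀ σ₀ Δσ₀)) λ ()
  match {Δ} z z∉Δ sat@(m₀ , w₀ , σ₀ , Δσ₀) (Ψ ∷ Ps) Qs settled h
    with ∈-map⁻ (λ Ψ → word z Ψ w₀ σ₀) (↭.∈-resp-↭ (h m₀ w₀ σ₀ Δσ₀) (here refl))
  ... | Ψ′ , Ψ′∈Qs , same-word with ∈-∃++ Ψ′∈Qs
  ... | xs , ys , refl = trans
    (cong+ (C4 z∉Δ (completeˢ Δ Ψ Ψ′ Ψ≈Ψ′)) (match z z∉Δ sat Ps (xs ++ ys) settled′ rest))
    (∑-↭ z (↭-sym (↭.shift Ψ′ xs ys)))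
    where
    Ψ≈Ψ′ : Δ ⊨ˢ Ψ ≈ Ψ′
    Ψ≈Ψ′ = agree {Ψ = Ψ} {Ψ′} Δσ₀ same-word (settled (here refl) Ψ′∈Qs)
    settled′ : ∀ {Ψ₁ Ψ₂} → Ψ₁ ∈ Ps → Ψ₂ ∈ xs ++ ys → LeavesSettled Δ z Ψ₁ Ψ₂
    settled′ ∈Ps ∈xs++ys with ∈-++⁻ xs ∈xs++ys
    ... | inj₁ ∈xs = settled (there ∈Ps) (∈-++⁺ˡ ∈xs)
    ... | inj₂ ∈ys = settled (there ∈Ps) (∈-++⁺ʳ xs (there ∈ys))
    rest : Words↭ Δ z Ps (xs ++ ys)
    rest m w σ Δσ = ≡.subst (_ ↭_) (≡.sym (List.map-++ W xs ys)) (↭.drop-mid [] (map W xs) (begin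
      W Ψ′ ∷ map W Ps             ≡⟨ cong (_∷ map W Ps) (List.map-cong (λ i →
                                       Ψ≈Ψ′ m w (σ [ z ↦¹ i ]) (All-Sat-↦¹ w σ i z∉Δ Δσ)) (allFin _)) ⟨
      W Ψ ∷ map W Ps              ↭⟨ h m w σ Δσ ⟩
      map W (xs ++ Ψ′ ∷ ys)       ≡⟨ List.map-++ W xs (Ψ′ ∷ ys) ⟩
      map W xs ++ W Ψ′ ∷ map W ys ∎))
      where
      open ↭.PermutationReasoning
      W : Step k R → List R
      W Ψ = word z Ψ w σ

  Decides : List (MSO k) → MSO k → Set
  Decides Δ φ = φ ∈ Δ ⊎ (¬ᴹ φ) ∈ Δ

  case-split : ∀ (Inv : MSO k → Set) Fs {Γ Φ₁ Φ₂} → All (λ F → Inv F × Inv (¬ᴹ F)) Fs → All Inv Γ →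
    (∀ {Δ} → Γ ⊆ Δ → All (Decides Δ) Fs → All Inv Δ → Δ ⊩ᶜ Φ₁ ≈ Φ₂) → Γ ⊩ᶜ Φ₁ ≈ Φ₂
  case-split Inv [] _ invΓ K = K id [] invΓ
  case-split Inv (F ∷ Fs) ((invF , inv¬F) ∷ invs) invΓ K = by-cases F
    (case-split Inv Fs invs (invF ∷ invΓ) λ ⊆Δ decided → K (⊆Δ ∘ there) (inj₁ (⊆Δ (here refl)) ∷ decided))
    (case-split Inv Fs invs (inv¬F ∷ invΓ) λ ⊆Δ decided → K (⊆Δ ∘ there) (inj₂ (⊆Δ (here refl)) ∷ decided))

  guards : FOVar → List (Step k R) → List (MSO k)
  guards z Ψs = map (∃¹ z) (cartesianProductWith _∧ᴹ_ πs πs)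
    where
    πs : List (MSO k)
    πs = concatMap (map proj₁ ∘ leaves) Ψs

  -- Split on every formula ∃z (π ∧ π′) for leaves π, π′; then match in each consistent case.
  complete-∑ : ∀ {Γ} z Ps Qs → All (λ φ → ¬ FreeFO z φ) Γ → ∑ z Ps ∼[ Γ ] ∑ z Qs → Γ ⊩ᶜ ∑ z Ps ≈ ∑ z Qs
  complete-∑ {Γ} z Ps Qs z∉Γ h = case-split (λ φ → ¬ FreeFO z φ) (guards z (Ps ++ Qs))
    (AllP.map⁺ (All.universal (λ _ → (λ (z≢z , _) → z≢z refl) , (λ (z≢z , _) → z≢z refl)) _)) z∉Γ branch
    where
    branch : ∀ {Δ} → Γ ⊆ Δ → All (Decides Δ) (guards z (Ps ++ Qs)) → All (λ φ → ¬ FreeFO z φ) Δ →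
      Δ ⊩ᶜ ∑ z Ps ≈ ∑ z Qs
    branch {Δ} Γ⊆Δ decided z∉Δ = by-satisfiability (satisfiable? Δ)
      where
      guard∈ : ∀ {Ψ π r} → Ψ ∈ Ps ++ Qs → (π , r) ∈ leaves Ψ → π ∈ concatMap (map proj₁ ∘ leaves) (Ps ++ Qs)
      guard∈ ∈Ψs ∈leaves = ∈-concat⁺′ (∈-map⁺ proj₁ ∈leaves) (∈-map⁺ (map proj₁ ∘ leaves) ∈Ψs)
      settled : ∀ {Ψ Ψ′} → Ψ ∈ Ps → Ψ′ ∈ Qs → LeavesSettled Δ z Ψ Ψ′
      settled ∈Ps ∈Qs ∈Ψ ∈Ψ′ with All.lookup decided
        (∈-map⁺ (∃¹ z) (∈-cartesianProductWith⁺ _∧ᴹ_ (guard∈ (∈-++⁺ˡ ∈Ps) ∈Ψ) (guard∈ (∈-++⁺ʳ Ps ∈Qs) ∈Ψ′)))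
      ... | inj₁ ∈Δ = inj₁ λ _ _ _ Δσ → All.lookup Δσ ∈Δ
      ... | inj₂ ∈Δ = inj₂ λ _ _ _ Δσ → All.lookup Δσ ∈Δ
      words : Words↭ Δ z Ps Qs
      words m w σ Δσ = ≡.subst₂ _↭_ (⟦∑⟧ z Ps w σ) (⟦∑⟧ z Qs w σ)
        (h m w σ (All.tabulate (All.lookup Δσ ∘ Γ⊆Δ)))
      by-satisfiability : Dec (Satisfiable Δ) → Δ ⊩ᶜ ∑ z Ps ≈ ∑ z Qs
      by-satisfiability (no ¬sat) = explosionᶜ ¬sat
      by-satisfiability (yes sat) = match z z∉Δ sat Ps Qs settled words

  complete-sop : ∀ {Γ Φ₁ Φ₂} → SumOfProducts Φ₁ → SumOfProducts Φ₂ → Φ₁ ∼[ Γ ] Φ₂ → Γ ⊩ᶜ Φ₁ ≈ Φ₂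
  complete-sop {Γ} {Φ₁} {Φ₂} sop₁ sop₂ h =
    trans Φ₁≈∑ (trans (complete-∑ z (renamed z sop₁) (renamed z sop₂) z∉Γ ∑∼∑) (sym Φ₂≈∑))
    where
    z : FOVar
    z = suc (supᶜ Φ₁ ⊔ supᶜ Φ₂ ⊔ supᴹ (⋀ Γ))
    Φ₁≈∑ : Γ ⊩ᶜ Φ₁ ≈ ∑ z (renamed z sop₁)
    Φ₁≈∑ = ∑-renamed z sop₁ (s≤s (ℕ.m≤n⇒m≤n⊔o (supᴹ (⋀ Γ)) (ℕ.m≤m⊔n _ (supᶜ Φ₂))))
    Φ₂≈∑ : Γ ⊩ᶜ Φ₂ ≈ ∑ z (renamed z sop₂)
    Φ₂≈∑ = ∑-renamed z sop₂ (s≤s (ℕ.m≤n⇒m≤n⊔o (supᴹ (⋀ Γ)) (ℕ.m≤n⊔m (supᶜ Φ₁) _)))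
    z∉Γ : All (λ φ → ¬ FreeFO z φ) Γ
    z∉Γ = fresh Γ (s≤s (ℕ.m≤n⊔m (supᶜ Φ₁ ⊔ supᶜ Φ₂) _))
      where
      fresh : ∀ Γ → supᴹ (⋀ Γ) < z → All (λ φ → ¬ FreeFO z φ) Γ
      fresh []      _   = []
      fresh (φ ∷ Γ) Γ<z = (λ f → ℕ.<⇒≱ (ℕ.m⊔n<o⇒m<o _ _ Γ<z) (OccFO-≤ φ (FreeFO⇒OccFO φ f)))
                        ∷ fresh Γ (ℕ.m⊔n<o⇒n<o _ _ Γ<z)
    ∑∼∑ : ∑ z (renamed z sop₁) ∼[ Γ ] ∑ z (renamed z sop₂)
    ∑∼∑ m w σ Γσ = ↭-trans (↭-sym (soundᶜ Φ₁≈∑ m w σ Γσ)) (↭-trans (h m w σ Γσ) (soundᶜ Φ₂≈∑ m w σ Γσ))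

  data Shape (Φ : Core k R) : Set where
    sum-of-products : SumOfProducts Φ → Shape Φ
    conditional : ∀ φ Φ′ Φ″ → conditionals Φ′ < conditionals Φ → conditionals Φ″ < conditionals Φ →
                  (∀ {Γ} → Γ ⊩ᶜ Φ ≈ (φ ?ᶜ Φ′ ∶ Φ″)) → Shape Φ

  -- C10 (with C2) pulls a conditional out of a sum.
  shape : ∀ Φ → Shape Φ
  shape 𝟎 = sum-of-products 𝟎
  shape (∏ x Ψ) = sum-of-products (∏ x Ψ)
  shape (φ ?ᶜ Φ₁ ∶ Φ₂) = conditional φ Φ₁ Φ₂ (s≤s (ℕ.m≤m+n _ _)) (s≤s (ℕ.m≤n+m _ _)) refl
  shape (Φ₁ ⊕ Φ₂) with shape Φ₁ | shape Φ₂
  ... | conditional φ Φ′ Φ″ <₁ <₂ d | _ = conditional φ (Φ′ ⊕ Φ₂) (Φ″ ⊕ Φ₂)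
    (ℕ.+-monoˡ-< _ <₁) (ℕ.+-monoˡ-< _ <₂) (trans (cong+ d refl) C10)
  ... | sum-of-products _ | conditional φ Φ′ Φ″ <₁ <₂ d = conditional φ (Φ₁ ⊕ Φ′) (Φ₁ ⊕ Φ″)
    (ℕ.+-monoʳ-< (conditionals Φ₁) <₁) (ℕ.+-monoʳ-< (conditionals Φ₁) <₂)
    (trans C2 (trans (cong+ d refl) (trans C10 (cong? C2 C2))))
  ... | sum-of-products s₁ | sum-of-products s₂ = sum-of-products (s₁ ⊕ s₂)

  completeᶜ : ∀ Γ Φ₁ Φ₂ → Φ₁ ∼[ Γ ] Φ₂ → Γ ⊩ᶜ Φ₁ ≈ Φ₂
  completeᶜ Γ Φ₁ Φ₂ = <-rec Complete complete′ _ Γ Φ₁ Φ₂ refl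
    where
    Complete : ℕ → Set
    Complete n = ∀ Γ Φ₁ Φ₂ → conditionals Φ₁ + conditionals Φ₂ ≡ n → Φ₁ ∼[ Γ ] Φ₂ → Γ ⊩ᶜ Φ₁ ≈ Φ₂
    complete′ : ∀ n → (∀ {n′} → n′ < n → Complete n′) → Complete n
    complete′ _ rec Γ Φ₁ Φ₂ refl h with shape Φ₁ | shape Φ₂
    ... | conditional φ Φ′ Φ″ <₁ <₂ d | _ = trans d (C9
      (rec (ℕ.+-monoˡ-< _ <₁) _ Φ′ Φ₂ refl (?ᶜ-branchˡ φ Φ′ Φ″ Φ₂ h′))
      (rec (ℕ.+-monoˡ-< _ <₂) _ Φ″ Φ₂ refl (?ᶜ-branchʳ φ Φ′ Φ″ Φ₂ h′)))
      where
      h′ : (φ ?ᶜ Φ′ ∶ Φ″) ∼[ Γ ] Φ₂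
      h′ m w σ Γσ = ↭-trans (↭-sym (soundᶜ d m w σ Γσ)) (h m w σ Γσ)
    ... | sum-of-products _ | conditional φ Φ′ Φ″ <₁ <₂ d = sym (trans d (C9
      (sym (rec (ℕ.+-monoʳ-< (conditionals Φ₁) <₁) _ Φ₁ Φ′ refl
                λ m w σ Γσ → ↭-sym (?ᶜ-branchˡ φ Φ′ Φ″ Φ₁ h′ m w σ Γσ)))
      (sym (rec (ℕ.+-monoʳ-< (conditionals Φ₁) <₂) _ Φ₁ Φ″ refl
                λ m w σ Γσ → ↭-sym (?ᶜ-branchʳ φ Φ′ Φ″ Φ₁ h′ m w σ Γσ)))))
      where
      h′ : (φ ?ᶜ Φ′ ∶ Φ″) ∼[ Γ ] Φ₁
      h′ m w σ Γσ = ↭-trans (↭-sym (soundᶜ d m w σ Γσ)) (↭-sym (h m w σ Γσ))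
    ... | sum-of-products s₁ | sum-of-products s₂ = complete-sop s₁ s₂ h

theorem4 : ∀ {k : ℕ} {R : Set} (_⊢_ : List (MSO k) → MSO k → Set) →
    SoundComplete _⊢_ →
    ∀ (Γ : List (MSO k)) (Φ₁ Φ₂ : Core k R) →
    (Φ₁ ∼[ Γ ] Φ₂) ⇔ (_⊢ᶜ_≈_ _⊢_ Γ Φ₁ Φ₂)
theorem4 _⊢_ ⊢-sound-complete Γ Φ₁ Φ₂ = mk⇔ (completeᶜ Γ Φ₁ Φ₂) soundᶜ
  where
  open Completeness _⊢_ ⊢-sound-complete
  open Soundness _⊢_ (proj₁ (⊢-sound-complete _ _))
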